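{- Let $l$ be a positive integer, $S$ a centred Catalan set of size $n+1$, $A$ an $(n,l)$-AS-trapezoid with $\mathcal{S}(A)=S$, and write $\mathbf{M}(S)=(m_1,\dots,m_n)$. Then for each $1\le i\le n$ the number of entries equal to $1$ in the $i$-th row (from the bottom) of $A$ is at most $1+\sum_{j=1}^i m_j$. Further, for $l\ge 2$ there exists an $(n,l)$-AS-trapezoid $A'$ with $\mathcal{S}(A')=S$ for which all these bounds are attained.
   Context: A centred Catalan set of size $m$ is an $m$-subset $S$ of $\{ -m+1,\dots,m-1\}$ with $|S\cap\{ -i,\dots,i\}|\ge i+1$ for all $0\le i\le m-1$. For $S$ of size $n+1$, $\mathbf{M}(S):=(m_1,\dots,m_n)$ with $m_i=|\{ -i,i\}\cap S|-1$. An $(n,l)$-AS-trapezoid is an array of $n$ centred rows, the $i$-th row from the bottom having $l+2i-1$ entries from $\{ -1,0,1\}$, such that all row sums are $1$, the column sums of the central $l-1$ columns are $0$, the nonzero entries in every row and in every column alternate in sign, and in every column the first nonzero entry from the top is positive. Label the columns $-n+1,\dots,l+n-1$ from left to right. $\mathcal{S}(A)$ is $\{0\}\cup\{c-1: c\le 0,\ \text{column } c\text{ has positive sum}\}\cup\{c-(l-1): c\ge1,\ \text{column } c\text{ has positive sum}\}$. -}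

module Defs where

open import Data.Bool using (Bool; true; false; not)
open import Data.Nat as ℕ using (ℕ; zero; suc; _∸_)
open import Data.Integer as ℤ using (ℤ; +_; -_; _+_; _-_; _≤_; _<_; 0ℤ; 1ℤ)
open import Data.Integer.Properties using (_≟_)
open import Data.List using (List; []; _∷_; map; foldr; length; filterᵇ)
open import Data.Product using (Σ; _×_)
open import Data.Sum using (_⊎_)
open import Data.Unit using (⊤)
open import Relation.Nullary using (¬_; does)
open import Relation.Binary.PropositionalEquality using (_≡_)

rangeFrom : ℤ → ℕ → List ℤ
rangeFrom a zero = []
rangeFrom a (suc k) = a ∷ rangeFrom (a + 1ℤ) k

topDown : ℕ → List ℕ
topDown zero = []
topDown (suc k) = suc k ∷ topDown k

sumℤ : List ℤ → ℤ
sumℤ = foldr _+_ 0ℤ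

count : (ℤ → Bool) → List ℤ → ℕ
count p xs = length (filterᵇ p xs)

CentredCatalan : ℕ → (ℤ → Bool) → Set
CentredCatalan m S =
  (∀ x → S x ≡ true → (1ℤ - + m ≤ x) × (x ≤ + m - 1ℤ))
  × (count S (rangeFrom (1ℤ - + m) (m ℕ.+ m ∸ 1)) ≡ m)
  × (∀ i → i ℕ.< m → suc i ℕ.≤ count S (rangeFrom (- + i) (suc (i ℕ.+ i))))

Mcoord : (ℤ → Bool) → ℕ → ℤ
Mcoord S i = + count S (- + i ∷ + i ∷ []) - 1ℤ

sumM : (ℤ → Bool) → ℕ → ℤ
sumM S zero = 0ℤ
sumM S (suc i) = sumM S i + Mcoord S (suc i)

-- An array is a function A : ℕ → ℤ → ℤ, A i c being the
-- entry in row i (counted from the bottom, 1 ≤ i ≤ n) and column c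
-- (columns labelled -n+1, ..., l+n-1).  Positions outside the
-- trapezoid are required to be 0 (so the encoding is unique).

InShape : ℕ → ℕ → ℕ → ℤ → Set
InShape n l i c = (1 ℕ.≤ i) × (i ℕ.≤ n) × (1ℤ - + i ≤ c) × (c ≤ + l + + i - 1ℤ)

row : ℕ → (ℕ → ℤ → ℤ) → ℕ → List ℤ
row l A i = map (A i) (rangeFrom (1ℤ - + i) (l ℕ.+ (i ℕ.+ i) ∸ 1))

column : ℕ → (ℕ → ℤ → ℤ) → ℤ → List ℤ
column n A c = map (λ i → A i c) (topDown n)

colSum : ℕ → (ℕ → ℤ → ℤ) → ℤ → ℤ
colSum n A c = sumℤ (column n A c)

nonzeros : List ℤ → List ℤ
nonzeros = filterᵇ (λ x → not (does (x ≟ 0ℤ)))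

Alternating : List ℤ → Set
Alternating [] = ⊤
Alternating (x ∷ []) = ⊤
Alternating (x ∷ y ∷ xs) = (y ≡ - x) × Alternating (y ∷ xs)

FirstPositive : List ℤ → Set
FirstPositive [] = ⊤
FirstPositive (x ∷ _) = 0ℤ < x

IsEntry : ℤ → Set
IsEntry x = (x ≡ - 1ℤ) ⊎ (x ≡ 0ℤ) ⊎ (x ≡ 1ℤ)

record IsASTrapezoid (n l : ℕ) (A : ℕ → ℤ → ℤ) : Set where
  field
    entries   : ∀ i c → IsEntry (A i c)
    outside   : ∀ i c → ¬ InShape n l i c → A i c ≡ 0ℤ
    rowSums   : ∀ i → 1 ℕ.≤ i → i ℕ.≤ n → sumℤ (row l A i) ≡ 1ℤ
    -- central l-1 columns are the columns 1, ..., l-1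
    colSums   : ∀ c → 1ℤ ≤ c → c ≤ + l - 1ℤ → colSum n A c ≡ 0ℤ
    rowAlt    : ∀ i → 1 ℕ.≤ i → i ℕ.≤ n → Alternating (nonzeros (row l A i))
    colAlt    : ∀ c → Alternating (nonzeros (column n A c))
    colFirst  : ∀ c → FirstPositive (nonzeros (column n A c))

InSA : ℕ → ℕ → (ℕ → ℤ → ℤ) → ℤ → Set
InSA n l A x =
  (x ≡ 0ℤ)
  ⊎ Σ ℤ (λ c → (c ≤ 0ℤ) × (0ℤ < colSum n A c) × (x ≡ c - 1ℤ))
  ⊎ Σ ℤ (λ c → (1ℤ ≤ c) × (0ℤ < colSum n A c) × (x ≡ c - (+ l - 1ℤ)))

SetOf≡ : ℕ → ℕ → (ℕ → ℤ → ℤ) → (ℤ → Bool) → Set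
SetOf≡ n l A S = ∀ x → (InSA n l A x → S x ≡ true) × (S x ≡ true → InSA n l A x)

ones : List ℤ → ℕ
ones = count (λ x → does (x ≟ 1ℤ))

module Submission where

-- Reading a column of an AS-trapezoid from the top, alternation with a positive first entry keeps
-- every partial sum in {0, 1}. So a 1 in row i forces the sum of its column over the rows i, …, n
-- to be 1, and the number of 1s in row i is at most the total of these partial sums over the
-- columns of row i: the sum of those column sums minus the row sums of rows 1, …, i - 1, which lie
-- inside the column range of row i. Column sums vanish in the centre and are read off from S
-- outside it, which gives the bound 1 + m_1 + … + m_i.
--
-- For l ≥ 2 the bound is attained by the trapezoid whose 1s in row i + 1 sit in the columns -i and
-- l + i when -(i + 1), resp. i + 1, lie in S, and one step to the right of every 1 of row i except
-- the rightmost one; the -1s of row i sit right below the latter. Then the partial column sums down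
-- to row i are the indicator of the 1s of row i, and these number 1 + m_1 + … + m_i: the ballot
-- condition on S keeps every row nonempty, and |S| = n + 1 empties the row above the top.

open import Defs
open import Data.Bool using (Bool; true; false)
open import Data.Nat using (ℕ; suc; _≤_)
open import Data.Integer using (ℤ; +_; _+_; 1ℤ) renaming (_≤_ to _≤ℤ_)
open import Data.Product using (Σ; _×_)
open import Relation.Binary.PropositionalEquality using (_≡_)

open import Data.Nat as ℕ using (zero; z≤n; s≤s)
import Data.Nat.Properties as ℕP
open import Data.Integer as ℤ using (-_; _-_; 0ℤ; -[1+_])
import Data.Integer.Properties as ℤP
open import Data.Integer.Tactic.RingSolver using (solve-∀)
open import Data.List using (List; []; _∷_; map; _++_; filter)
open import Data.List.Properties using (map-++; map-∘; map-cong-local)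
open import Data.List.Membership.Propositional using (_∈_; find; lose)
open import Data.List.Membership.Propositional.Properties
  using (∈-map⁻; ∈-map⁺; ∈-++⁻; ∈-++⁺ˡ; ∈-++⁺ʳ; ∈-filter⁻; ∈-filter⁺)
open import Data.List.Membership.DecPropositional ℤ._≟_ using (_∈?_)
open import Data.List.Relation.Unary.Any using (Any; here; there; any?)
open import Data.List.Relation.Unary.All as All using (All; []; _∷_; all?)
open import Data.List.Relation.Unary.All.Properties using (¬All⇒Any¬)
open import Data.Product using (_,_; proj₁; proj₂)
open import Data.Sum using (_⊎_; inj₁; inj₂)
open import Data.Unit using (⊤; tt)
open import Data.Empty using (⊥; ⊥-elim)
open import Function using (_∘_; case_of_)
open import Relation.Binary.Definitions using (tri<; tri≈; tri>)
open import Relation.Nullary using (¬_; Dec; yes; no; does)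
open import Relation.Nullary.Decidable using (_×-dec_)
open import Relation.Binary.PropositionalEquality
  using (_≢_; refl; sym; trans; cong; cong₂; subst; module ≡-Reasoning)

i<j⇒i+1≤j : ∀ {a b} → a ℤ.< b → a + 1ℤ ℤ.≤ b
i<j⇒i+1≤j {a} p = ℤP.≤-trans (ℤP.≤-reflexive (ℤP.+-comm a 1ℤ)) (ℤP.i<j⇒suc[i]≤j p)

i+1≤j⇒i<j : ∀ {a b} → a + 1ℤ ℤ.≤ b → a ℤ.< b
i+1≤j⇒i<j {a} p = ℤP.suc[i]≤j⇒i<j (ℤP.≤-trans (ℤP.≤-reflexive (ℤP.+-comm 1ℤ a)) p)

i<j⇒i≤j-1 : ∀ {a b} → a ℤ.< b → a ℤ.≤ b - 1ℤ
i<j⇒i≤j-1 {b = b} p = ℤP.≤-trans (ℤP.i<j⇒i≤pred[j] p) (ℤP.≤-reflexive (ℤP.+-comm (- 1ℤ) b))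

i≤j-1⇒i<j : ∀ {a b} → a ℤ.≤ b - 1ℤ → a ℤ.< b
i≤j-1⇒i<j {b = b} p = ℤP.i≤pred[j]⇒i<j (ℤP.≤-trans p (ℤP.≤-reflexive (ℤP.+-comm b (- 1ℤ))))

i-1<i : ∀ a → a - 1ℤ ℤ.< a
i-1<i a = i≤j-1⇒i<j ℤP.≤-refl

i<i+1 : ∀ a → a ℤ.< a + 1ℤ
i<i+1 a = i+1≤j⇒i<j ℤP.≤-refl

i<i+[1+j] : ∀ a d → a ℤ.< a + + suc d
i<i+[1+j] a d = ℤP.≤-<-trans (ℤP.≤-reflexive (sym (ℤP.+-identityʳ a))) (ℤP.+-monoʳ-< a (ℤ.+<+ (s≤s z≤n)))

-[1+i]≡-i-1 : ∀ i → - + suc i ≡ - + i - 1ℤ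
-[1+i]≡-i-1 i = trans (cong -_ (ℤP.pos-+ 1 i)) (lemma (+ i))
  where
  lemma : ∀ x → - (1ℤ + x) ≡ - x - 1ℤ
  lemma = solve-∀

i+1-1≡i : ∀ c → c + 1ℤ - 1ℤ ≡ c
i+1-1≡i = solve-∀

i-1+1≡i : ∀ c → c - 1ℤ + 1ℤ ≡ c
i-1+1≡i = solve-∀

1≰0 : ¬ 1ℤ ℤ.≤ 0ℤ
1≰0 (ℤ.+≤+ ())

i-k≡j⇒i≡j+k : ∀ k {x y} → x - k ≡ y → x ≡ y + k
i-k≡j⇒i≡j+k k {x} refl = lemma x k
  where
  lemma : ∀ x k → x ≡ x - k + k
  lemma = solve-∀

i-j≡k⇒j≡i-k : ∀ {i j k} → i - j ≡ k → j ≡ i - k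
i-j≡k⇒j≡i-k {i} {j} refl = lemma i j
  where
  lemma : ∀ i j → j ≡ i - (i - j)
  lemma = solve-∀

i-k≡j-k⇒i≡j : ∀ k {x y} → x - k ≡ y - k → x ≡ y
i-k≡j-k⇒i≡j k {y = y} e = trans (i-k≡j⇒i≡j+k k e) (lemma y k)
  where
  lemma : ∀ y k → y - k + k ≡ y
  lemma = solve-∀

false≢true : false ≢ true
false≢true ()

𝟙 : Bool → ℤ
𝟙 true = 1ℤ
𝟙 false = 0ℤ

Bit : ℤ → Set
Bit z = (z ≡ 0ℤ) ⊎ (z ≡ 1ℤ)

𝟙-bit : ∀ b → Bit (𝟙 b)
𝟙-bit true = inj₂ refl
𝟙-bit false = inj₁ refl

𝟙≤1 : ∀ b → 𝟙 b ℤ.≤ 1ℤ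
𝟙≤1 true = ℤP.≤-refl
𝟙≤1 false = ℤ.+≤+ z≤n

𝟙-pos⇒true : ∀ {b} → 0ℤ ℤ.< 𝟙 b → b ≡ true
𝟙-pos⇒true {true} _ = refl
𝟙-pos⇒true {false} (ℤ.+<+ ())

bit-nonneg : ∀ {z} → Bit z → 0ℤ ℤ.≤ z
bit-nonneg (inj₁ refl) = ℤP.≤-refl
bit-nonneg (inj₂ refl) = ℤ.+≤+ z≤n

bit-pos⇒1 : ∀ {z} → Bit z → 0ℤ ℤ.< z → z ≡ 1ℤ
bit-pos⇒1 (inj₁ refl) (ℤ.+<+ ())
bit-pos⇒1 (inj₂ e) _ = e

bit-nonpos⇒0 : ∀ {z} → Bit z → ¬ 0ℤ ℤ.< z → z ≡ 0ℤ
bit-nonpos⇒0 (inj₁ e) _ = e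
bit-nonpos⇒0 (inj₂ refl) h = ⊥-elim (h (ℤ.+<+ (s≤s z≤n)))

𝟙-does⁺ : ∀ {P : Set} (d : Dec P) → P → 𝟙 (does d) ≡ 1ℤ
𝟙-does⁺ (yes _) _ = refl
𝟙-does⁺ (no ¬p) p = ⊥-elim (¬p p)

𝟙-does⁻ : ∀ {P : Set} (d : Dec P) → ¬ P → 𝟙 (does d) ≡ 0ℤ
𝟙-does⁻ (yes p) ¬p = ⊥-elim (¬p p)
𝟙-does⁻ (no _) _ = refl

𝟙-does≡𝟙 : ∀ {P : Set} (d : Dec P) {b} → (P → b ≡ true) → (b ≡ true → P) → 𝟙 (does d) ≡ 𝟙 b
𝟙-does≡𝟙 (yes p) to from = cong 𝟙 (sym (to p))
𝟙-does≡𝟙 (no ¬p) {true} to from = ⊥-elim (¬p (from refl))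
𝟙-does≡𝟙 (no ¬p) {false} to from = refl

count≡sumℤ-𝟙 : ∀ (p : ℤ → Bool) xs → + count p xs ≡ sumℤ (map (𝟙 ∘ p) xs)
count≡sumℤ-𝟙 p [] = refl
count≡sumℤ-𝟙 p (x ∷ xs) with p x
... | true = cong (_+_ 1ℤ) (count≡sumℤ-𝟙 p xs)
... | false = trans (count≡sumℤ-𝟙 p xs) (sym (ℤP.+-identityˡ _))

sumℤ-++ : ∀ xs ys → sumℤ (xs ++ ys) ≡ sumℤ xs + sumℤ ys
sumℤ-++ [] ys = sym (ℤP.+-identityˡ _)
sumℤ-++ (x ∷ xs) ys = trans (cong (_+_ x) (sumℤ-++ xs ys)) (sym (ℤP.+-assoc x _ _))

sumℤ-map-++ : ∀ (f : ℤ → ℤ) xs ys → sumℤ (map f (xs ++ ys)) ≡ sumℤ (map f xs) + sumℤ (map f ys)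
sumℤ-map-++ f xs ys = trans (cong sumℤ (map-++ f xs ys)) (sumℤ-++ (map f xs) (map f ys))

sumℤ-map-cong : ∀ {f g : ℤ → ℤ} xs → (∀ {x} → x ∈ xs → f x ≡ g x) → sumℤ (map f xs) ≡ sumℤ (map g xs)
sumℤ-map-cong [] h = refl
sumℤ-map-cong (x ∷ xs) h = cong₂ _+_ (h (here refl)) (sumℤ-map-cong xs (h ∘ there))

sumℤ-map-mono : ∀ {f g : ℤ → ℤ} xs → (∀ {x} → x ∈ xs → f x ℤ.≤ g x) → sumℤ (map f xs) ℤ.≤ sumℤ (map g xs)
sumℤ-map-mono [] h = ℤP.≤-refl
sumℤ-map-mono (x ∷ xs) h = ℤP.+-mono-≤ (h (here refl)) (sumℤ-map-mono xs (h ∘ there))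

sumℤ-map-zero : ∀ {f : ℤ → ℤ} xs → (∀ {x} → x ∈ xs → f x ≡ 0ℤ) → sumℤ (map f xs) ≡ 0ℤ
sumℤ-map-zero [] h = refl
sumℤ-map-zero (x ∷ xs) h = cong₂ _+_ (h (here refl)) (sumℤ-map-zero xs (h ∘ there))

sumℤ-map-+ : ∀ (f g : ℤ → ℤ) xs → sumℤ (map (λ x → f x + g x) xs) ≡ sumℤ (map f xs) + sumℤ (map g xs)
sumℤ-map-+ f g [] = refl
sumℤ-map-+ f g (x ∷ xs) = trans (cong (_+_ (f x + g x)) (sumℤ-map-+ f g xs)) (lemma (f x) (g x) _ _)
  where
  lemma : ∀ a b c d → (a + b) + (c + d) ≡ (a + c) + (b + d)
  lemma = solve-∀

sumℤ-map-- : ∀ (f g : ℤ → ℤ) xs → sumℤ (map (λ x → f x - g x) xs) ≡ sumℤ (map f xs) - sumℤ (map g xs)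
sumℤ-map-- f g [] = refl
sumℤ-map-- f g (x ∷ xs) = trans (cong (_+_ (f x - g x)) (sumℤ-map-- f g xs)) (lemma (f x) (g x) _ _)
  where
  lemma : ∀ a b c d → (a - b) + (c - d) ≡ (a + c) - (b + d)
  lemma = solve-∀

sumℤ-map-nonneg : ∀ (f : ℤ → ℤ) xs → (∀ x → 0ℤ ℤ.≤ f x) → 0ℤ ℤ.≤ sumℤ (map f xs)
sumℤ-map-nonneg f [] h = ℤP.≤-refl
sumℤ-map-nonneg f (x ∷ xs) h = ℤP.+-mono-≤ (h x) (sumℤ-map-nonneg f xs h)

∈⇒≤sumℤ-map : ∀ (f : ℤ → ℤ) {xs y} → (∀ x → 0ℤ ℤ.≤ f x) → y ∈ xs → f y ℤ.≤ sumℤ (map f xs)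
∈⇒≤sumℤ-map f {x ∷ xs} h (here refl) =
  ℤP.≤-trans (ℤP.≤-reflexive (sym (ℤP.+-identityʳ (f x)))) (ℤP.+-monoʳ-≤ (f x) (sumℤ-map-nonneg f xs h))
∈⇒≤sumℤ-map f {x ∷ xs} {y} h (there m) =
  ℤP.≤-trans (ℤP.≤-reflexive (sym (ℤP.+-identityˡ (f y)))) (ℤP.+-mono-≤ (h x) (∈⇒≤sumℤ-map f h m))

-- Alternating sign vectors via prefix sums

BitPrefixSums : ℤ → List ℤ → Set
BitPrefixSums b [] = ⊤
BitPrefixSums b (x ∷ xs) = Bit (b + x) × BitPrefixSums (b + x) xs

AlternatingFrom : ℤ → List ℤ → Set
AlternatingFrom s [] = ⊤
AlternatingFrom s (x ∷ xs) = (x ≡ s) × AlternatingFrom (- s) xs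

alternatingFrom⇒alternating : ∀ s xs → AlternatingFrom s xs → Alternating xs
alternatingFrom⇒alternating s [] _ = tt
alternatingFrom⇒alternating s (x ∷ []) _ = tt
alternatingFrom⇒alternating s (x ∷ y ∷ xs) (refl , y≡-x , a) =
  y≡-x , alternatingFrom⇒alternating (- s) (y ∷ xs) (y≡-x , a)

alternatingFrom1⇒firstPositive : ∀ xs → AlternatingFrom 1ℤ xs → FirstPositive xs
alternatingFrom1⇒firstPositive [] _ = tt
alternatingFrom1⇒firstPositive (x ∷ xs) (refl , _) = ℤ.+<+ (s≤s z≤n)

mutual
  bitPrefixSums0⇒alternatingFrom : ∀ xs → BitPrefixSums 0ℤ xs → AlternatingFrom 1ℤ (nonzeros xs)
  bitPrefixSums0⇒alternatingFrom [] _ = tt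
  bitPrefixSums0⇒alternatingFrom (+ zero ∷ xs) (_ , p) = bitPrefixSums0⇒alternatingFrom xs p
  bitPrefixSums0⇒alternatingFrom (+ suc zero ∷ xs) (_ , p) = refl , bitPrefixSums1⇒alternatingFrom xs p
  bitPrefixSums0⇒alternatingFrom (+ suc (suc _) ∷ xs) (inj₁ () , _)
  bitPrefixSums0⇒alternatingFrom (+ suc (suc _) ∷ xs) (inj₂ () , _)
  bitPrefixSums0⇒alternatingFrom (-[1+ _ ] ∷ xs) (inj₁ () , _)
  bitPrefixSums0⇒alternatingFrom (-[1+ _ ] ∷ xs) (inj₂ () , _)

  bitPrefixSums1⇒alternatingFrom : ∀ xs → BitPrefixSums 1ℤ xs → AlternatingFrom (- 1ℤ) (nonzeros xs)
  bitPrefixSums1⇒alternatingFrom [] _ = tt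
  bitPrefixSums1⇒alternatingFrom (+ zero ∷ xs) (_ , p) = bitPrefixSums1⇒alternatingFrom xs p
  bitPrefixSums1⇒alternatingFrom (+ suc _ ∷ xs) (inj₁ () , _)
  bitPrefixSums1⇒alternatingFrom (+ suc _ ∷ xs) (inj₂ () , _)
  bitPrefixSums1⇒alternatingFrom (-[1+ zero ] ∷ xs) (_ , p) = refl , bitPrefixSums0⇒alternatingFrom xs p
  bitPrefixSums1⇒alternatingFrom (-[1+ suc _ ] ∷ xs) (inj₁ () , _)
  bitPrefixSums1⇒alternatingFrom (-[1+ suc _ ] ∷ xs) (inj₂ () , _)

bitPrefixSums⇒alternating : ∀ xs → BitPrefixSums 0ℤ xs → Alternating (nonzeros xs)
bitPrefixSums⇒alternating xs p = alternatingFrom⇒alternating 1ℤ _ (bitPrefixSums0⇒alternatingFrom xs p)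

bitPrefixSums⇒firstPositive : ∀ xs → BitPrefixSums 0ℤ xs → FirstPositive (nonzeros xs)
bitPrefixSums⇒firstPositive xs p = alternatingFrom1⇒firstPositive _ (bitPrefixSums0⇒alternatingFrom xs p)

HeadIs : ℤ → List ℤ → Set
HeadIs s [] = ⊤
HeadIs s (y ∷ _) = y ≡ s

FirstNegative : List ℤ → Set
FirstNegative [] = ⊤
FirstNegative (y ∷ _) = y ℤ.< 0ℤ

alternating-tail : ∀ x ys → Alternating (x ∷ ys) → HeadIs (- x) ys × Alternating ys
alternating-tail x [] _ = tt , tt
alternating-tail x (y ∷ ys) a = a

headIs1⇒firstPositive : ∀ ys → HeadIs 1ℤ ys → FirstPositive ys
headIs1⇒firstPositive [] _ = tt
headIs1⇒firstPositive (y ∷ ys) refl = ℤ.+<+ (s≤s z≤n)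

headIs-1⇒firstNegative : ∀ ys → HeadIs (- 1ℤ) ys → FirstNegative ys
headIs-1⇒firstNegative [] _ = tt
headIs-1⇒firstNegative (y ∷ ys) refl = ℤ.-<+

alternating⇒bitPrefixSums01 : ∀ {xs} → All IsEntry xs → Alternating (nonzeros xs) →
  (FirstPositive (nonzeros xs) → BitPrefixSums 0ℤ xs) × (FirstNegative (nonzeros xs) → BitPrefixSums 1ℤ xs)
alternating⇒bitPrefixSums01 [] _ = (λ _ → tt) , (λ _ → tt)
alternating⇒bitPrefixSums01 (inj₂ (inj₁ refl) ∷ es) a =
  let (p₀ , p₁) = alternating⇒bitPrefixSums01 es a
  in (λ h → inj₁ refl , p₀ h) , (λ h → inj₂ refl , p₁ h)
alternating⇒bitPrefixSums01 {_ ∷ xs} (inj₂ (inj₂ refl) ∷ es) a =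
  let (hd , a′) = alternating-tail 1ℤ (nonzeros xs) a
  in (λ _ → inj₂ refl , proj₂ (alternating⇒bitPrefixSums01 es a′) (headIs-1⇒firstNegative _ hd))
   , λ { (ℤ.+<+ ()) }
alternating⇒bitPrefixSums01 {_ ∷ xs} (inj₁ refl ∷ es) a =
  let (hd , a′) = alternating-tail (- 1ℤ) (nonzeros xs) a
  in (λ ())
   , (λ _ → inj₁ refl , proj₁ (alternating⇒bitPrefixSums01 es a′) (headIs1⇒firstPositive _ hd))

alternating⇒bitPrefixSums : ∀ {xs} → All IsEntry xs → Alternating (nonzeros xs) →
  FirstPositive (nonzeros xs) → BitPrefixSums 0ℤ xs
alternating⇒bitPrefixSums es a = proj₁ (alternating⇒bitPrefixSums01 es a)

rangeFrom-snoc : ∀ a k → rangeFrom a (suc k) ≡ rangeFrom a k ++ (a + + k) ∷ []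
rangeFrom-snoc a zero = cong (_∷ []) (sym (ℤP.+-identityʳ a))
rangeFrom-snoc a (suc k) =
  cong (a ∷_) (trans (rangeFrom-snoc (a + 1ℤ) k) (cong (λ z → rangeFrom (a + 1ℤ) k ++ z ∷ []) (ℤP.+-assoc a 1ℤ (+ k))))

rangeFrom-suc-suc : ∀ a k → rangeFrom a (suc (suc k)) ≡ a ∷ (rangeFrom (a + 1ℤ) k ++ (a + 1ℤ + + k) ∷ [])
rangeFrom-suc-suc a k = cong (a ∷_) (rangeFrom-snoc (a + 1ℤ) k)

∈rangeFrom⁻ : ∀ a k {x} → x ∈ rangeFrom a k → (a ℤ.≤ x) × (x ℤ.< a + + k)
∈rangeFrom⁻ a (suc k) (here refl) = ℤP.≤-refl , i<i+[1+j] a k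
∈rangeFrom⁻ a (suc k) (there m) =
  let (p , q) = ∈rangeFrom⁻ (a + 1ℤ) k m
  in ℤP.≤-trans (ℤP.i≤i+j a 1ℤ) p , ℤP.<-≤-trans q (ℤP.≤-reflexive (ℤP.+-assoc a 1ℤ (+ k)))

∈rangeFrom⁺ : ∀ a k {x} → a ℤ.≤ x → x ℤ.< a + + k → x ∈ rangeFrom a k
∈rangeFrom⁺ a zero p q = ⊥-elim (ℤP.≤⇒≯ p (ℤP.<-≤-trans q (ℤP.≤-reflexive (ℤP.+-identityʳ a))))
∈rangeFrom⁺ a (suc k) {x} p q with x ℤ.≟ a
... | yes refl = here refl
... | no x≢a = there (∈rangeFrom⁺ (a + 1ℤ) k (i<j⇒i+1≤j (ℤP.≤∧≢⇒< p (x≢a ∘ sym)))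
                        (ℤP.<-≤-trans q (ℤP.≤-reflexive (sym (ℤP.+-assoc a 1ℤ (+ k))))))

module _ (f h : ℤ → ℤ) where

  telescope-rangeFrom : ∀ a k → (∀ {c} → c ∈ rangeFrom a k → h (c + 1ℤ) ≡ h c + f c) →
    h a + sumℤ (map f (rangeFrom a k)) ≡ h (a + + k)
  telescope-rangeFrom a zero step = trans (ℤP.+-identityʳ (h a)) (cong h (sym (ℤP.+-identityʳ a)))
  telescope-rangeFrom a (suc k) step = begin
    h a + (f a + sumℤ (map f (rangeFrom (a + 1ℤ) k))) ≡⟨ ℤP.+-assoc (h a) (f a) _ ⟨
    h a + f a + sumℤ (map f (rangeFrom (a + 1ℤ) k))   ≡⟨ cong (_+ _) (step (here refl)) ⟨
    h (a + 1ℤ) + sumℤ (map f (rangeFrom (a + 1ℤ) k)) ≡⟨ telescope-rangeFrom (a + 1ℤ) k (step ∘ there) ⟩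
    h (a + 1ℤ + + k)                                  ≡⟨ cong h (ℤP.+-assoc a 1ℤ (+ k)) ⟩
    h (a + + suc k)                                   ∎
    where open ≡-Reasoning

  bitPrefixSums-rangeFrom : ∀ a k → (∀ {c} → c ∈ rangeFrom a k → h (c + 1ℤ) ≡ h c + f c) →
    (∀ {c} → c ∈ rangeFrom a k → Bit (h (c + 1ℤ))) → BitPrefixSums (h a) (map f (rangeFrom a k))
  bitPrefixSums-rangeFrom a zero step bit = tt
  bitPrefixSums-rangeFrom a (suc k) step bit =
    subst (λ z → Bit z × BitPrefixSums z (map f (rangeFrom (a + 1ℤ) k))) (step (here refl))
      (bit (here refl) , bitPrefixSums-rangeFrom (a + 1ℤ) k (step ∘ there) (bit ∘ there))

sumTo : (ℕ → ℤ) → ℕ → ℤ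
sumTo f zero = 0ℤ
sumTo f (suc k) = sumTo f k + f (suc k)

sumℤ-topDown : ∀ (f : ℕ → ℤ) k → sumℤ (map f (topDown k)) ≡ sumTo f k
sumℤ-topDown f zero = refl
sumℤ-topDown f (suc k) = trans (cong (_+_ (f (suc k))) (sumℤ-topDown f k)) (ℤP.+-comm (f (suc k)) (sumTo f k))

sumTo-cong : ∀ {f g : ℕ → ℤ} k → (∀ {j} → 1 ≤ j → j ≤ k → f j ≡ g j) → sumTo f k ≡ sumTo g k
sumTo-cong zero h = refl
sumTo-cong (suc k) h = cong₂ _+_ (sumTo-cong k (λ p q → h p (ℕP.m≤n⇒m≤1+n q))) (h (s≤s z≤n) ℕP.≤-refl)

sumTo-1 : ∀ k → sumTo (λ _ → 1ℤ) k ≡ + k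
sumTo-1 zero = refl
sumTo-1 (suc k) = trans (cong (_+ 1ℤ) (sumTo-1 k)) (ℤP.+-comm (+ k) 1ℤ)

sumℤ-map-sumTo : ∀ (F : ℕ → ℤ → ℤ) xs k →
  sumℤ (map (λ c → sumTo (λ j → F j c) k) xs) ≡ sumTo (λ j → sumℤ (map (F j) xs)) k
sumℤ-map-sumTo F xs zero = sumℤ-map-zero xs (λ _ → refl)
sumℤ-map-sumTo F xs (suc k) =
  trans (sumℤ-map-+ (λ c → sumTo (λ j → F j c) k) (F (suc k)) xs) (cong (_+ sumℤ (map (F (suc k)) xs)) (sumℤ-map-sumTo F xs k))

module _ (f st : ℕ → ℤ) (k : ℕ) (step : ∀ {i} → 1 ≤ i → i ≤ k → st i ≡ st (suc i) + f i) where

  telescope-sumTo : ∀ i → i ≤ k → st 1 ≡ st (suc i) + sumTo f i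
  telescope-sumTo zero _ = sym (ℤP.+-identityʳ _)
  telescope-sumTo (suc i) p = begin
    st 1                                          ≡⟨ telescope-sumTo i (ℕP.<⇒≤ p) ⟩
    st (suc i) + sumTo f i                        ≡⟨ cong (_+ sumTo f i) (step (s≤s z≤n) p) ⟩
    st (suc (suc i)) + f (suc i) + sumTo f i      ≡⟨ lemma (st (suc (suc i))) (f (suc i)) (sumTo f i) ⟩
    st (suc (suc i)) + (sumTo f i + f (suc i))    ∎
    where
    open ≡-Reasoning
    lemma : ∀ a b c → a + b + c ≡ a + (c + b)
    lemma = solve-∀

  bitPrefixSums-topDown : (∀ {i} → 1 ≤ i → i ≤ k → Bit (st i)) → BitPrefixSums (st (suc k)) (map f (topDown k))
  bitPrefixSums-topDown bit = go k ℕP.≤-refl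
    where
    go : ∀ m → m ≤ k → BitPrefixSums (st (suc m)) (map f (topDown m))
    go zero _ = tt
    go (suc m) p = subst (λ z → Bit z × BitPrefixSums z (map f (topDown m))) (step (s≤s z≤n) p)
      (bit (s≤s z≤n) p , go m (ℕP.<⇒≤ p))

bitPrefixSums-topDown⇒bit : ∀ (f : ℕ → ℤ) b k → Bit b → BitPrefixSums b (map f (topDown k)) →
  ∀ i → i ≤ k → Bit (b + sumTo f k - sumTo f i)
bitPrefixSums-topDown⇒bit f b zero bit _ zero _ = subst Bit (sym (lemma b)) bit
  where
  lemma : ∀ b → b + 0ℤ - 0ℤ ≡ b
  lemma = solve-∀
bitPrefixSums-topDown⇒bit f b (suc k) bit (bit′ , p) i i≤ with i ℕ.≟ suc k
... | yes refl = subst Bit (sym (lemma b (sumTo f (suc k)))) bit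
  where
  lemma : ∀ b c → b + c - c ≡ b
  lemma = solve-∀
... | no i≢ = subst Bit (lemma b (f (suc k)) (sumTo f k) (sumTo f i))
                (bitPrefixSums-topDown⇒bit f (b + f (suc k)) k bit′ p i (ℕP.≤-pred (ℕP.≤∧≢⇒< i≤ i≢)))
  where
  lemma : ∀ b x c d → b + x + c - d ≡ b + (c + x) - d
  lemma = solve-∀

rowCols : ℕ → ℕ → List ℤ
rowCols l i = rangeFrom (1ℤ - + i) (l ℕ.+ (i ℕ.+ i) ℕ.∸ 1)

InRow : ℕ → ℕ → ℤ → Set
InRow l i c = (1ℤ - + i ℤ.≤ c) × (c ℤ.≤ + l + + i - 1ℤ)

1-[1+i]≡-i : ∀ i → 1ℤ - + suc i ≡ - + i
1-[1+i]≡-i i = trans (cong (_-_ 1ℤ) (ℤP.pos-+ 1 i)) (lemma (+ i))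
  where
  lemma : ∀ x → 1ℤ - (1ℤ + x) ≡ - x
  lemma = solve-∀

l+[1+i]-1≡l+i : ∀ l i → + l + + suc i - 1ℤ ≡ + l + + i
l+[1+i]-1≡l+i l i = trans (cong (λ z → + l + z - 1ℤ) (ℤP.pos-+ 1 i)) (lemma (+ l) (+ i))
  where
  lemma : ∀ a x → a + (1ℤ + x) - 1ℤ ≡ a + x
  lemma = solve-∀

rowCols-end : ∀ l′ i → 1ℤ - + i + + (suc l′ ℕ.+ (i ℕ.+ i) ℕ.∸ 1) ≡ + suc l′ + + i
rowCols-end l′ i = begin
  1ℤ - + i + + (l′ ℕ.+ (i ℕ.+ i))    ≡⟨ cong (_+_ (1ℤ - + i)) (trans (ℤP.pos-+ l′ (i ℕ.+ i)) (cong (_+_ (+ l′)) (ℤP.pos-+ i i))) ⟩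
  1ℤ - + i + (+ l′ + (+ i + + i))    ≡⟨ lemma (+ l′) (+ i) ⟩
  1ℤ + + l′ + + i                    ≡⟨ cong (_+ + i) (ℤP.pos-+ 1 l′) ⟨
  + suc l′ + + i                     ∎
  where
  open ≡-Reasoning
  lemma : ∀ a b → 1ℤ - b + (a + (b + b)) ≡ 1ℤ + a + b
  lemma = solve-∀

rowCols-suc : ∀ l′ i → rowCols (suc l′) (suc i) ≡ - + i ∷ (rowCols (suc l′) i ++ (+ suc l′ + + i) ∷ [])
rowCols-suc l′ i = begin
  rangeFrom (1ℤ - + suc i) (l′ ℕ.+ (suc i ℕ.+ suc i))
    ≡⟨ cong (rangeFrom (1ℤ - + suc i)) length≡ ⟩
  rangeFrom (1ℤ - + suc i) (suc (suc (l′ ℕ.+ (i ℕ.+ i))))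
    ≡⟨ rangeFrom-suc-suc (1ℤ - + suc i) (l′ ℕ.+ (i ℕ.+ i)) ⟩
  (1ℤ - + suc i) ∷ (rangeFrom (1ℤ - + suc i + 1ℤ) k ++ (1ℤ - + suc i + 1ℤ + + k) ∷ [])
    ≡⟨ cong₂ (λ x y → x ∷ (rangeFrom y k ++ (y + + k) ∷ [])) (1-[1+i]≡-i i) start≡ ⟩
  - + i ∷ (rowCols (suc l′) i ++ (1ℤ - + i + + k) ∷ [])
    ≡⟨ cong (λ z → - + i ∷ (rowCols (suc l′) i ++ z ∷ [])) (rowCols-end l′ i) ⟩
  - + i ∷ (rowCols (suc l′) i ++ (+ suc l′ + + i) ∷ [])
    ∎
  where
  open ≡-Reasoning
  k = l′ ℕ.+ (i ℕ.+ i)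
  length≡ : l′ ℕ.+ (suc i ℕ.+ suc i) ≡ suc (suc k)
  length≡ = trans (ℕP.+-suc l′ (i ℕ.+ suc i)) (cong suc (trans (cong (l′ ℕ.+_) (ℕP.+-suc i i)) (ℕP.+-suc l′ (i ℕ.+ i))))
  start≡ : 1ℤ - + suc i + 1ℤ ≡ 1ℤ - + i
  start≡ = trans (cong (_+ 1ℤ) (1-[1+i]≡-i i)) (ℤP.+-comm (- + i) 1ℤ)

∈rowCols⁻ : ∀ l′ i {c} → c ∈ rowCols (suc l′) i → InRow (suc l′) i c
∈rowCols⁻ l′ i m =
  let (p , q) = ∈rangeFrom⁻ _ _ m
  in p , subst (λ z → _ ℤ.≤ z - 1ℤ) (rowCols-end l′ i) (i<j⇒i≤j-1 q)

∈rowCols⁺ : ∀ l′ i {c} → InRow (suc l′) i c → c ∈ rowCols (suc l′) i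
∈rowCols⁺ l′ i (p , q) = ∈rangeFrom⁺ _ _ p (i≤j-1⇒i<j (subst (λ z → _ ℤ.≤ z - 1ℤ) (sym (rowCols-end l′ i)) q))

ones-row : ∀ l (A : ℕ → ℤ → ℤ) i → + ones (row l A i) ≡ sumℤ (map (λ c → 𝟙 (does (A i c ℤ.≟ 1ℤ))) (rowCols l i))
ones-row l A i = trans (count≡sumℤ-𝟙 _ (map (A i) (rowCols l i))) (cong sumℤ (sym (map-∘ (rowCols l i))))

-- Column sums prescribed by a set

columnSumOf : ℕ → (ℤ → Bool) → ℤ → ℤ
columnSumOf l S c with c ℤ.≤? 0ℤ
... | yes _ = 𝟙 (S (c - 1ℤ))
... | no _ with + l ℤ.≤? c
...   | yes _ = 𝟙 (S (c - (+ l - 1ℤ)))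
...   | no _ = 0ℤ

module _ (l : ℕ) (S : ℤ → Bool) where

  columnSumOf-bit : ∀ c → Bit (columnSumOf l S c)
  columnSumOf-bit c with c ℤ.≤? 0ℤ
  ... | yes _ = 𝟙-bit _
  ... | no _ with + l ℤ.≤? c
  ...   | yes _ = 𝟙-bit _
  ...   | no _ = inj₁ refl

  columnSumOf-≤0 : ∀ {c} → c ℤ.≤ 0ℤ → columnSumOf l S c ≡ 𝟙 (S (c - 1ℤ))
  columnSumOf-≤0 {c} c≤0 with c ℤ.≤? 0ℤ
  ... | yes _ = refl
  ... | no c≰0 = ⊥-elim (c≰0 c≤0)

  columnSumOf-≥l : ∀ {c} → 1ℤ ℤ.≤ c → + l ℤ.≤ c → columnSumOf l S c ≡ 𝟙 (S (c - (+ l - 1ℤ)))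
  columnSumOf-≥l {c} 1≤c l≤c with c ℤ.≤? 0ℤ
  ... | yes c≤0 = ⊥-elim (1≰0 (ℤP.≤-trans 1≤c c≤0))
  ... | no _ with + l ℤ.≤? c
  ...   | yes _ = refl
  ...   | no l≰c = ⊥-elim (l≰c l≤c)

  columnSumOf-central : ∀ {c} → 1ℤ ℤ.≤ c → c ℤ.≤ + l - 1ℤ → columnSumOf l S c ≡ 0ℤ
  columnSumOf-central {c} 1≤c c≤l-1 with c ℤ.≤? 0ℤ
  ... | yes c≤0 = ⊥-elim (1≰0 (ℤP.≤-trans 1≤c c≤0))
  ... | no _ with + l ℤ.≤? c
  ...   | yes l≤c = ⊥-elim (ℤP.≤⇒≯ l≤c (i≤j-1⇒i<j c≤l-1))
  ...   | no _ = refl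

  columnSumOf-left : ∀ i → columnSumOf l S (- + i) ≡ 𝟙 (S (- + suc i))
  columnSumOf-left i = trans (columnSumOf-≤0 (ℤP.neg-≤-pos {i} {0})) (cong (𝟙 ∘ S) (sym (-[1+i]≡-i-1 i)))

  columnSumOf-right : 1 ≤ l → ∀ i → columnSumOf l S (+ l + + i) ≡ 𝟙 (S (+ suc i))
  columnSumOf-right 1≤l i =
    trans (columnSumOf-≥l (ℤP.≤-trans (ℤ.+≤+ 1≤l) (ℤP.i≤i+j (+ l) (+ i))) (ℤP.i≤i+j (+ l) (+ i)))
          (cong (𝟙 ∘ S) (trans (lemma (+ l) (+ i)) (sym (ℤP.pos-+ 1 i))))
    where
    lemma : ∀ a x → a + x - (a - 1ℤ) ≡ 1ℤ + x
    lemma = solve-∀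

sumM-suc : ∀ S i → sumM S (suc i) ≡ sumM S i + (𝟙 (S (- + suc i)) + 𝟙 (S (+ suc i)) - 1ℤ)
sumM-suc S i = cong (λ z → sumM S i + (z - 1ℤ))
  (trans (count≡sumℤ-𝟙 S (- + suc i ∷ + suc i ∷ [])) (cong (_+_ (𝟙 (S (- + suc i)))) (ℤP.+-identityʳ _)))

sumℤ-columnSumOf-rowCols : ∀ l′ S i → sumℤ (map (columnSumOf (suc l′) S) (rowCols (suc l′) i)) ≡ + i + sumM S i
sumℤ-columnSumOf-rowCols l′ S zero =
  sumℤ-map-zero (rowCols (suc l′) 0) λ {c} m →
    let (p , q) = ∈rowCols⁻ l′ 0 m
    in columnSumOf-central (suc l′) S p (subst (λ z → c ℤ.≤ z - 1ℤ) (ℤP.+-identityʳ (+ suc l′)) q)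
sumℤ-columnSumOf-rowCols l′ S (suc i) = begin
  sumℤ (map E (rowCols l (suc i)))
    ≡⟨ cong (sumℤ ∘ map E) (rowCols-suc l′ i) ⟩
  E (- + i) + sumℤ (map E (rowCols l i ++ (+ l + + i) ∷ []))
    ≡⟨ cong (_+_ (E (- + i))) (sumℤ-map-++ E (rowCols l i) _) ⟩
  E (- + i) + (sumℤ (map E (rowCols l i)) + (E (+ l + + i) + 0ℤ))
    ≡⟨ cong₂ (λ x y → x + (sumℤ (map E (rowCols l i)) + (y + 0ℤ)))
         (columnSumOf-left l S i) (columnSumOf-right l S (s≤s z≤n) i) ⟩
  a + (sumℤ (map E (rowCols l i)) + (b + 0ℤ))
    ≡⟨ cong (λ z → a + (z + (b + 0ℤ))) (sumℤ-columnSumOf-rowCols l′ S i) ⟩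
  a + ((+ i + sumM S i) + (b + 0ℤ))
    ≡⟨ lemma a b (+ i) (sumM S i) ⟩
  1ℤ + + i + (sumM S i + (a + b - 1ℤ))
    ≡⟨ cong₂ _+_ (sym (ℤP.pos-+ 1 i)) (sym (sumM-suc S i)) ⟩
  + suc i + sumM S (suc i)
    ∎
  where
  open ≡-Reasoning
  l = suc l′
  E = columnSumOf l S
  a = 𝟙 (S (- + suc i))
  b = 𝟙 (S (+ suc i))
  lemma : ∀ a b x s → a + ((x + s) + (b + 0ℤ)) ≡ 1ℤ + x + (s + (a + b - 1ℤ))
  lemma = solve-∀

module _ (l′ n : ℕ) (A : ℕ → ℤ → ℤ) (S : ℤ → Bool) where
  private
    l = suc l′

  -- The only column that can witness its own label (c - 1, resp. c - (l - 1)) in 𝒮(A) is c itself: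
  -- the other candidates are the label 0 or a central column, whose sum vanishes.
  colSum≡columnSumOf : (∀ c → Bit (colSum n A c)) →
    (∀ c → 1ℤ ℤ.≤ c → c ℤ.≤ + l - 1ℤ → colSum n A c ≡ 0ℤ) →
    SetOf≡ n l A S → ∀ c → colSum n A c ≡ columnSumOf l S c
  colSum≡columnSumOf bit central so c with c ℤ.≤? 0ℤ
  ... | yes c≤0 with S (c - 1ℤ) in eq
  ...   | true = bit-pos⇒1 (bit c) (positive (proj₂ (so (c - 1ℤ)) eq))
    where
    positive : InSA n l A (c - 1ℤ) → 0ℤ ℤ.< colSum n A c
    positive (inj₁ c-1≡0) = ⊥-elim (ℤP.<-irrefl c-1≡0 (ℤP.<-≤-trans (i-1<i c) c≤0))
    positive (inj₂ (inj₁ (c′ , _ , pos , e))) = subst (λ z → 0ℤ ℤ.< colSum n A z) (sym (i-k≡j-k⇒i≡j 1ℤ e)) pos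
    positive (inj₂ (inj₂ (c′ , 1≤c′ , pos , e))) = ⊥-elim (ℤP.<-irrefl (sym (central c′ 1≤c′ c′≤l-1)) pos)
      where
      c′≤l-1 : c′ ℤ.≤ + l - 1ℤ
      c′≤l-1 = subst (ℤ._≤ + l - 1ℤ) (sym (i-k≡j⇒i≡j+k (+ l - 1ℤ) (sym e)))
        (ℤP.≤-trans (ℤP.+-monoˡ-≤ (+ l - 1ℤ) (ℤP.i≤j⇒i-k≤j 1ℤ c≤0)) (ℤP.≤-reflexive (ℤP.+-identityˡ _)))
  ...   | false = bit-nonpos⇒0 (bit c) λ pos →
    false≢true (trans (sym eq) (proj₁ (so (c - 1ℤ)) (inj₂ (inj₁ (c , c≤0 , pos , refl)))))
  colSum≡columnSumOf bit central so c | no c≰0 with + l ℤ.≤? c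
  ... | no l≰c = central c (i<j⇒i+1≤j (ℤP.≰⇒> c≰0)) (i<j⇒i≤j-1 (ℤP.≰⇒> l≰c))
  ... | yes l≤c with S (c - (+ l - 1ℤ)) in eq
  ...   | true = bit-pos⇒1 (bit c) (positive (proj₂ (so _) eq))
    where
    1≤x : 1ℤ ℤ.≤ c - (+ l - 1ℤ)
    1≤x = ℤP.≤-trans (ℤP.≤-reflexive (lemma (+ l))) (ℤP.+-monoˡ-≤ (- (+ l - 1ℤ)) l≤c)
      where
      lemma : ∀ a → 1ℤ ≡ a - (a - 1ℤ)
      lemma = solve-∀
    positive : InSA n l A (c - (+ l - 1ℤ)) → 0ℤ ℤ.< colSum n A c
    positive (inj₁ x≡0) = ⊥-elim (1≰0 (subst (1ℤ ℤ.≤_) x≡0 1≤x))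
    positive (inj₂ (inj₁ (c′ , c′≤0 , _ , e))) =
      ⊥-elim (1≰0 (ℤP.≤-trans 1≤x (subst (ℤ._≤ 0ℤ) (sym e) (ℤP.i≤j⇒i-k≤j 1ℤ c′≤0))))
    positive (inj₂ (inj₂ (c′ , _ , pos , e))) =
      subst (λ z → 0ℤ ℤ.< colSum n A z) (sym (i-k≡j-k⇒i≡j (+ l - 1ℤ) e)) pos
  ...   | false = bit-nonpos⇒0 (bit c) λ pos →
    false≢true (trans (sym eq) (proj₁ (so _) (inj₂ (inj₂ (c , i<j⇒i+1≤j (ℤP.≰⇒> c≰0) , pos , refl)))))

  columnSumOf⇒setOf≡ : S 0ℤ ≡ true → (∀ c → colSum n A c ≡ columnSumOf l S c) → SetOf≡ n l A S
  columnSumOf⇒setOf≡ S0 colSum≡ x = sufficient , necessary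
    where
    positive⇒S : ∀ {c y} → columnSumOf l S c ≡ 𝟙 (S y) → 0ℤ ℤ.< colSum n A c → S y ≡ true
    positive⇒S e pos = 𝟙-pos⇒true (subst (0ℤ ℤ.<_) (trans (colSum≡ _) e) pos)

    S⇒positive : ∀ {c y} → columnSumOf l S c ≡ 𝟙 (S y) → S y ≡ true → 0ℤ ℤ.< colSum n A c
    S⇒positive e Sy = subst (0ℤ ℤ.<_) (sym (trans (colSum≡ _) (trans e (cong 𝟙 Sy)))) (ℤ.+<+ (s≤s z≤n))

    sufficient : InSA n l A x → S x ≡ true
    sufficient (inj₁ refl) = S0
    sufficient (inj₂ (inj₁ (c , c≤0 , pos , refl))) = positive⇒S (columnSumOf-≤0 l S c≤0) pos
    sufficient (inj₂ (inj₂ (c , 1≤c , pos , refl))) with + l ℤ.≤? c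
    ... | yes l≤c = positive⇒S (columnSumOf-≥l l S 1≤c l≤c) pos
    ... | no l≰c = ⊥-elim (ℤP.<-irrefl (sym (trans (colSum≡ c) (columnSumOf-central l S 1≤c (i<j⇒i≤j-1 (ℤP.≰⇒> l≰c))))) pos)

    necessary : S x ≡ true → InSA n l A x
    necessary Sx with ℤP.<-cmp x 0ℤ
    ... | tri≈ _ x≡0 _ = inj₁ x≡0
    ... | tri< x<0 _ _ =
      inj₂ (inj₁ (x + 1ℤ , i<j⇒i+1≤j x<0
                 , S⇒positive (trans (columnSumOf-≤0 l S (i<j⇒i+1≤j x<0)) (cong (𝟙 ∘ S) (i+1-1≡i x))) Sx
                 , sym (i+1-1≡i x)))
    ... | tri> _ _ x>0 =
      inj₂ (inj₂ (c , 1≤c , S⇒positive (trans (columnSumOf-≥l l S 1≤c l≤c) (cong (𝟙 ∘ S) (lemma x (+ l)))) Sx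
                 , sym (lemma x (+ l))))
      where
      c = x + (+ l - 1ℤ)
      lemma : ∀ x a → x + (a - 1ℤ) - (a - 1ℤ) ≡ x
      lemma = solve-∀
      l≤c : + l ℤ.≤ c
      l≤c = ℤP.≤-trans (ℤP.≤-reflexive (lemma′ (+ l))) (ℤP.+-monoˡ-≤ (+ l - 1ℤ) (i<j⇒i+1≤j x>0))
        where
        lemma′ : ∀ a → a ≡ 0ℤ + 1ℤ + (a - 1ℤ)
        lemma′ = solve-∀
      1≤c : 1ℤ ℤ.≤ c
      1≤c = ℤP.≤-trans (ℤ.+≤+ (s≤s z≤n)) l≤c

-- The upper bound

module UpperBound (l′ n : ℕ) (A : ℕ → ℤ → ℤ) (S : ℤ → Bool)
                  (trapezoid : IsASTrapezoid n (suc l′) A) (setOf≡ : SetOf≡ n (suc l′) A S) where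
  open IsASTrapezoid trapezoid
  private
    l = suc l′

  column-bitPrefixSums : ∀ c → BitPrefixSums 0ℤ (column n A c)
  column-bitPrefixSums c = alternating⇒bitPrefixSums (entries′ n) (colAlt c) (colFirst c)
    where
    entries′ : ∀ k → All IsEntry (map (λ j → A j c) (topDown k))
    entries′ zero = []
    entries′ (suc k) = entries (suc k) c ∷ entries′ k

  colSumAbove : ℤ → ℕ → ℤ
  colSumAbove c k = colSum n A c - sumTo (λ j → A j c) k

  colSumAbove-bit : ∀ c k → k ≤ n → Bit (colSumAbove c k)
  colSumAbove-bit c k k≤n =
    subst Bit (cong (_- sumTo (λ j → A j c) k) (trans (ℤP.+-identityˡ _) (sym (sumℤ-topDown (λ j → A j c) n))))
      (bitPrefixSums-topDown⇒bit (λ j → A j c) 0ℤ n (inj₁ refl) (column-bitPrefixSums c) k k≤n)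

  colSum-bit : ∀ c → Bit (colSum n A c)
  colSum-bit c = subst Bit (ℤP.+-identityʳ _) (colSumAbove-bit c 0 z≤n)

  isOne≤colSumAbove : ∀ k c → suc k ≤ n → 𝟙 (does (A (suc k) c ℤ.≟ 1ℤ)) ℤ.≤ colSumAbove c k
  isOne≤colSumAbove k c k<n with A (suc k) c ℤ.≟ 1ℤ
  ... | no _ = bit-nonneg (colSumAbove-bit c k (ℕP.<⇒≤ k<n))
  ... | yes A≡1 = ℤP.≤-trans (ℤP.+-monoˡ-≤ 1ℤ (bit-nonneg (colSumAbove-bit c (suc k) k<n))) (ℤP.≤-reflexive above≡)
    where
    lemma : ∀ s t x → s - (t + x) + x ≡ s - t
    lemma = solve-∀
    above≡ : colSumAbove c (suc k) + 1ℤ ≡ colSumAbove c k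
    above≡ = trans (cong (_+_ (colSumAbove c (suc k))) (sym A≡1))
                   (lemma (colSum n A c) (sumTo (λ j → A j c) k) (A (suc k) c))

  rowSum-widen : ∀ j d → sumℤ (map (A j) (rowCols l (j ℕ.+ d))) ≡ sumℤ (map (A j) (rowCols l j))
  rowSum-widen j zero = cong (λ z → sumℤ (map (A j) (rowCols l z))) (ℕP.+-identityʳ j)
  rowSum-widen j (suc d) = begin
    sumℤ (map (A j) (rowCols l (j ℕ.+ suc d)))
      ≡⟨ cong (λ z → sumℤ (map (A j) (rowCols l z))) (ℕP.+-suc j d) ⟩
    sumℤ (map (A j) (rowCols l (suc (j ℕ.+ d))))
      ≡⟨ cong (sumℤ ∘ map (A j)) (rowCols-suc l′ (j ℕ.+ d)) ⟩
    A j (- + (j ℕ.+ d)) + sumℤ (map (A j) (rowCols l (j ℕ.+ d) ++ (+ l + + (j ℕ.+ d)) ∷ []))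
      ≡⟨ cong (_+_ (A j (- + (j ℕ.+ d)))) (sumℤ-map-++ (A j) (rowCols l (j ℕ.+ d)) _) ⟩
    A j (- + (j ℕ.+ d)) + (sumℤ (map (A j) (rowCols l (j ℕ.+ d))) + (A j (+ l + + (j ℕ.+ d)) + 0ℤ))
      ≡⟨ cong₂ (λ x y → x + (sumℤ (map (A j) (rowCols l (j ℕ.+ d))) + (y + 0ℤ))) left≡0 right≡0 ⟩
    0ℤ + (sumℤ (map (A j) (rowCols l (j ℕ.+ d))) + 0ℤ)
      ≡⟨ trans (ℤP.+-identityˡ _) (ℤP.+-identityʳ _) ⟩
    sumℤ (map (A j) (rowCols l (j ℕ.+ d)))
      ≡⟨ rowSum-widen j d ⟩
    sumℤ (map (A j) (rowCols l j))
      ∎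
    where
    open ≡-Reasoning
    left≡0 : A j (- + (j ℕ.+ d)) ≡ 0ℤ
    left≡0 = outside j _ λ (_ , _ , p , _) → ℤP.≤⇒≯ p (subst (- + (j ℕ.+ d) ℤ.<_) (sym e) (i<i+[1+j] _ d))
      where
      lemma : ∀ a b → 1ℤ - a ≡ - (a + b) + (1ℤ + b)
      lemma = solve-∀
      e : 1ℤ - + j ≡ - + (j ℕ.+ d) + + suc d
      e = trans (lemma (+ j) (+ d)) (cong₂ (λ x y → - x + y) (sym (ℤP.pos-+ j d)) (sym (ℤP.pos-+ 1 d)))
    right≡0 : A j (+ l + + (j ℕ.+ d)) ≡ 0ℤ
    right≡0 = outside j _ λ (_ , _ , _ , p) → ℤP.≤⇒≯ p (subst (+ l + + j - 1ℤ ℤ.<_) (sym e) (i<i+[1+j] _ d))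
      where
      lemma : ∀ a b c → a + (b + c) ≡ (a + b - 1ℤ) + (1ℤ + c)
      lemma = solve-∀
      e : + l + + (j ℕ.+ d) ≡ (+ l + + j - 1ℤ) + + suc d
      e = trans (cong (_+_ (+ l)) (ℤP.pos-+ j d)) (trans (lemma (+ l) (+ j) (+ d)) (cong (_+_ (+ l + + j - 1ℤ)) (sym (ℤP.pos-+ 1 d))))

  sumℤ-colSumAbove : ∀ k → suc k ≤ n → sumℤ (map (λ c → colSumAbove c k) (rowCols l (suc k))) ≡ 1ℤ + sumM S (suc k)
  sumℤ-colSumAbove k k<n = begin
    sumℤ (map (λ c → colSumAbove c k) cols)
      ≡⟨ sumℤ-map-- (colSum n A) (λ c → sumTo (λ j → A j c) k) cols ⟩
    sumℤ (map (colSum n A) cols) - sumℤ (map (λ c → sumTo (λ j → A j c) k) cols)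
      ≡⟨ cong₂ _-_ colSums≡ (sumℤ-map-sumTo A cols k) ⟩
    + suc k + sumM S (suc k) - sumTo (λ j → sumℤ (map (A j) cols)) k
      ≡⟨ cong (λ z → + suc k + sumM S (suc k) - z) (trans (sumTo-cong k rowSum≡1) (sumTo-1 k)) ⟩
    + suc k + sumM S (suc k) - + k
      ≡⟨ cong (λ z → z + sumM S (suc k) - + k) (ℤP.pos-+ 1 k) ⟩
    1ℤ + + k + sumM S (suc k) - + k
      ≡⟨ lemma (+ k) (sumM S (suc k)) ⟩
    1ℤ + sumM S (suc k)
      ∎
    where
    open ≡-Reasoning
    cols = rowCols l (suc k)
    lemma : ∀ x s → 1ℤ + x + s - x ≡ 1ℤ + s
    lemma = solve-∀
    colSums≡ : sumℤ (map (colSum n A) cols) ≡ + suc k + sumM S (suc k)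
    colSums≡ = trans (sumℤ-map-cong cols (λ {c} _ → colSum≡columnSumOf l′ n A S colSum-bit colSums setOf≡ c))
                     (sumℤ-columnSumOf-rowCols l′ S (suc k))
    rowSum≡1 : ∀ {j} → 1 ≤ j → j ≤ k → sumℤ (map (A j) cols) ≡ 1ℤ
    rowSum≡1 {j} 1≤j j≤k = trans
      (trans (cong (λ z → sumℤ (map (A j) (rowCols l z))) (sym (ℕP.m+[n∸m]≡n (ℕP.m≤n⇒m≤1+n j≤k)))) (rowSum-widen j (suc k ℕ.∸ j)))
      (rowSums j 1≤j (ℕP.≤-trans j≤k (ℕP.<⇒≤ k<n)))

  ones-row≤ : ∀ i → 1 ≤ i → i ≤ n → + ones (row l A i) ℤ.≤ 1ℤ + sumM S i
  ones-row≤ (suc k) _ k<n = begin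
    + ones (row l A (suc k))                                   ≡⟨ ones-row l A (suc k) ⟩
    sumℤ (map (λ c → 𝟙 (does (A (suc k) c ℤ.≟ 1ℤ))) cols)    ≤⟨ sumℤ-map-mono cols (λ {c} _ → isOne≤colSumAbove k c k<n) ⟩
    sumℤ (map (λ c → colSumAbove c k) cols)                    ≡⟨ sumℤ-colSumAbove k k<n ⟩
    1ℤ + sumM S (suc k)                                        ∎
    where
    open ℤP.≤-Reasoning
    cols = rowCols l (suc k)

-- Centred Catalan sets

module CentredCatalanProperties (n : ℕ) (S : ℤ → Bool) (catalan : CentredCatalan (suc n) S) where
  private
    S⊆ = proj₁ catalan
    size≡ = proj₁ (proj₂ catalan)
    ballot = proj₂ (proj₂ catalan)

  count-centred : ∀ i → sumℤ (map (𝟙 ∘ S) (rangeFrom (- + i) (suc (i ℕ.+ i)))) ≡ 𝟙 (S 0ℤ) + (+ i + sumM S i)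
  count-centred zero = refl
  count-centred (suc i) = begin
    sumℤ (map (𝟙 ∘ S) (rangeFrom (- + suc i) (suc (suc i ℕ.+ suc i))))
      ≡⟨ cong (sumℤ ∘ map (𝟙 ∘ S)) range≡ ⟩
    a + sumℤ (map (𝟙 ∘ S) (rangeFrom (- + i) (suc (i ℕ.+ i)) ++ + suc i ∷ []))
      ≡⟨ cong (_+_ a) (sumℤ-map-++ (𝟙 ∘ S) (rangeFrom (- + i) (suc (i ℕ.+ i))) _) ⟩
    a + (sumℤ (map (𝟙 ∘ S) (rangeFrom (- + i) (suc (i ℕ.+ i)))) + (b + 0ℤ))
      ≡⟨ cong (λ z → a + (z + (b + 0ℤ))) (count-centred i) ⟩
    a + ((𝟙 (S 0ℤ) + (+ i + sumM S i)) + (b + 0ℤ))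
      ≡⟨ lemma a b (𝟙 (S 0ℤ)) (+ i) (sumM S i) ⟩
    𝟙 (S 0ℤ) + ((1ℤ + + i) + (sumM S i + (a + b - 1ℤ)))
      ≡⟨ cong₂ (λ x y → 𝟙 (S 0ℤ) + (x + y)) (sym (ℤP.pos-+ 1 i)) (sym (sumM-suc S i)) ⟩
    𝟙 (S 0ℤ) + (+ suc i + sumM S (suc i))
      ∎
    where
    open ≡-Reasoning
    a = 𝟙 (S (- + suc i))
    b = 𝟙 (S (+ suc i))
    lemma : ∀ a b z x s → a + ((z + (x + s)) + (b + 0ℤ)) ≡ z + ((1ℤ + x) + (s + (a + b - 1ℤ)))
    lemma = solve-∀
    start≡ : - + suc i + 1ℤ ≡ - + i
    start≡ = trans (cong (_+ 1ℤ) (-[1+i]≡-i-1 i)) (i-1+1≡i (- + i))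
    end≡ : - + suc i + 1ℤ + + suc (i ℕ.+ i) ≡ + suc i
    end≡ = trans (cong₂ _+_ start≡ (trans (ℤP.pos-+ 1 (i ℕ.+ i)) (cong (_+_ 1ℤ) (ℤP.pos-+ i i))))
                 (trans (lemma′ (+ i)) (sym (ℤP.pos-+ 1 i)))
      where
      lemma′ : ∀ x → - x + (1ℤ + (x + x)) ≡ 1ℤ + x
      lemma′ = solve-∀
    range≡ : rangeFrom (- + suc i) (suc (suc i ℕ.+ suc i))
           ≡ - + suc i ∷ (rangeFrom (- + i) (suc (i ℕ.+ i)) ++ + suc i ∷ [])
    range≡ = trans (cong (λ k → rangeFrom (- + suc i) (suc k)) (ℕP.+-suc (suc i) i))
      (trans (rangeFrom-suc-suc (- + suc i) (suc (i ℕ.+ i)))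
        (cong₂ (λ x y → - + suc i ∷ (rangeFrom x (suc (i ℕ.+ i)) ++ y ∷ [])) start≡ end≡))

  0∈S : S 0ℤ ≡ true
  0∈S with S 0ℤ | ballot 0 (s≤s z≤n)
  ... | true | _ = refl
  ... | false | ()

  sumM-nonneg : ∀ i → i ≤ n → 0ℤ ℤ.≤ sumM S i
  sumM-nonneg i i≤n = ℤP.≤-trans (ℤP.i≤j⇒0≤j-i 1+i≤) (ℤP.≤-reflexive (lemma (+ i) (sumM S i)))
    where
    lemma : ∀ x s → 1ℤ + (x + s) - (1ℤ + x) ≡ s
    lemma = solve-∀
    1+i≤ : 1ℤ + + i ℤ.≤ 1ℤ + (+ i + sumM S i)
    1+i≤ = begin
      1ℤ + + i                                                   ≡⟨ ℤP.pos-+ 1 i ⟨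
      + suc i                                                    ≤⟨ ℤ.+≤+ (ballot i (s≤s i≤n)) ⟩
      + count S (rangeFrom (- + i) (suc (i ℕ.+ i)))              ≡⟨ count≡sumℤ-𝟙 S _ ⟩
      sumℤ (map (𝟙 ∘ S) (rangeFrom (- + i) (suc (i ℕ.+ i))))    ≡⟨ count-centred i ⟩
      𝟙 (S 0ℤ) + (+ i + sumM S i)                                ≤⟨ ℤP.+-monoˡ-≤ _ (𝟙≤1 (S 0ℤ)) ⟩
      1ℤ + (+ i + sumM S i)                                      ∎
      where open ℤP.≤-Reasoning

  sumM-top : sumM S n ≡ 0ℤ
  sumM-top = cancel-1+n (begin
    1ℤ + (+ n + sumM S n)                                              ≡⟨ cong (λ b → 𝟙 b + (+ n + sumM S n)) 0∈S ⟨
    𝟙 (S 0ℤ) + (+ n + sumM S n)                                        ≡⟨ count-centred n ⟨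
    sumℤ (map (𝟙 ∘ S) (rangeFrom (- + n) (suc (n ℕ.+ n))))            ≡⟨ count≡sumℤ-𝟙 S _ ⟨
    + count S (rangeFrom (- + n) (suc (n ℕ.+ n)))                      ≡⟨ cong (λ xs → + count S xs) range≡ ⟨
    + count S (rangeFrom (1ℤ - + suc n) (suc n ℕ.+ suc n ℕ.∸ 1))      ≡⟨ cong +_ size≡ ⟩
    + suc n                                                            ≡⟨ ℤP.pos-+ 1 n ⟩
    1ℤ + + n                                                           ∎)
    where
    open ≡-Reasoning
    range≡ : rangeFrom (1ℤ - + suc n) (suc n ℕ.+ suc n ℕ.∸ 1) ≡ rangeFrom (- + n) (suc (n ℕ.+ n))
    range≡ = cong₂ rangeFrom (1-[1+i]≡-i n) (ℕP.+-suc n n)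
    cancel-1+n : 1ℤ + (+ n + sumM S n) ≡ 1ℤ + + n → sumM S n ≡ 0ℤ
    cancel-1+n e = trans (lemma (+ n) (sumM S n)) (trans (cong (_- (1ℤ + + n)) e) (ℤP.+-inverseʳ (1ℤ + + n)))
      where
      lemma : ∀ x s → s ≡ 1ℤ + (x + s) - (1ℤ + x)
      lemma = solve-∀

  S-bounded : ∀ {x} → S x ≡ true → (- + n ℤ.≤ x) × (x ℤ.≤ + n)
  S-bounded {x} Sx =
    let (p , q) = S⊆ x Sx
    in subst (ℤ._≤ x) (1-[1+i]≡-i n) p , subst (x ℤ.≤_) (l+[1+i]-1≡l+i 0 n) q

  S-right : ∀ {x} → + n ℤ.< x → S x ≡ false
  S-right {x} n<x with S x in Sx
  ... | true = ⊥-elim (ℤP.≤⇒≯ (proj₂ (S-bounded Sx)) n<x)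
  ... | false = refl

  S-left : ∀ {x} → x ℤ.< - + n → S x ≡ false
  S-left {x} x<-n with S x in Sx
  ... | true = ⊥-elim (ℤP.≤⇒≯ (proj₁ (S-bounded Sx)) x<-n)
  ... | false = refl

-- The extremal trapezoid

onlyIf : Bool → ℤ → List ℤ
onlyIf true x = x ∷ []
onlyIf false x = []

∈onlyIf⁻ : ∀ {b x y} → y ∈ onlyIf b x → (b ≡ true) × (y ≡ x)
∈onlyIf⁻ {true} (here e) = refl , e

∈onlyIf⁺ : ∀ {b x} → b ≡ true → x ∈ onlyIf b x
∈onlyIf⁺ refl = here refl

¬All<⇒≤ : ∀ {x} xs → ¬ All (ℤ._< x) xs → Σ ℤ (λ y → (y ∈ xs) × (x ℤ.≤ y))
¬All<⇒≤ {x} xs ¬all =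
  let (y , y∈ , y≮x) = find (¬All⇒Any¬ (ℤ._<? x) xs ¬all) in y , y∈ , ℤP.≮⇒≥ y≮x

module Construction (l″ n : ℕ) (S : ℤ → Bool) (catalan : CentredCatalan (suc n) S) where
  open CentredCatalanProperties n S catalan

  l′ = suc l″
  l = suc l′

  NotRightmost : List ℤ → ℤ → Set
  NotRightmost xs c = Any (c ℤ.<_) xs

  notRightmost? : ∀ xs c → Dec (NotRightmost xs c)
  notRightmost? xs c = any? (c ℤ.<?_) xs

  -- Plus i lists the columns of the 1s in row i of the trapezoid A′ defined below.
  Plus : ℕ → List ℤ
  Plus zero = []
  Plus (suc i) = onlyIf (S (- + suc i)) (- + i) ++ onlyIf (S (+ suc i)) (+ l + + i)
                 ++ map (_+ 1ℤ) (filter (notRightmost? (Plus i)) (Plus i))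

  Shifted : ℕ → ℤ → Set
  Shifted i c = (c - 1ℤ ∈ Plus i) × NotRightmost (Plus i) (c - 1ℤ)

  ∈Plus-suc⁻ : ∀ i {c} → c ∈ Plus (suc i) →
    (S (- + suc i) ≡ true × c ≡ - + i) ⊎ (S (+ suc i) ≡ true × c ≡ + l + + i) ⊎ Shifted i c
  ∈Plus-suc⁻ i m with ∈-++⁻ (onlyIf (S (- + suc i)) (- + i)) m
  ... | inj₁ m′ = inj₁ (∈onlyIf⁻ m′)
  ... | inj₂ m′ with ∈-++⁻ (onlyIf (S (+ suc i)) (+ l + + i)) m′
  ...   | inj₁ m″ = inj₂ (inj₁ (∈onlyIf⁻ m″))
  ...   | inj₂ m″ with ∈-map⁻ (_+ 1ℤ) m″
  ...     | y , y∈ , refl =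
    let (y∈Plus , y<) = ∈-filter⁻ (notRightmost? (Plus i)) y∈
    in inj₂ (inj₂ (subst (_∈ Plus i) (sym (i+1-1≡i y)) y∈Plus , subst (NotRightmost (Plus i)) (sym (i+1-1≡i y)) y<))

  ∈Plus-suc⁺-left : ∀ i → S (- + suc i) ≡ true → - + i ∈ Plus (suc i)
  ∈Plus-suc⁺-left i e = ∈-++⁺ˡ (∈onlyIf⁺ e)

  ∈Plus-suc⁺-right : ∀ i → S (+ suc i) ≡ true → + l + + i ∈ Plus (suc i)
  ∈Plus-suc⁺-right i e = ∈-++⁺ʳ (onlyIf (S (- + suc i)) (- + i)) (∈-++⁺ˡ (∈onlyIf⁺ e))

  ∈Plus-suc⁺-shifted : ∀ i {c} → Shifted i c → c ∈ Plus (suc i)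
  ∈Plus-suc⁺-shifted i {c} (m , r) =
    ∈-++⁺ʳ (onlyIf (S (- + suc i)) (- + i)) (∈-++⁺ʳ (onlyIf (S (+ suc i)) (+ l + + i))
      (subst (_∈ map (_+ 1ℤ) (filter (notRightmost? (Plus i)) (Plus i))) (i-1+1≡i c)
        (∈-map⁺ (_+ 1ℤ) (∈-filter⁺ (notRightmost? (Plus i)) m r))))

  -i<start : ∀ i → - + i ℤ.< 1ℤ - + i
  -i<start i = subst (- + i ℤ.<_) (ℤP.+-comm (- + i) 1ℤ) (i<i+1 (- + i))

  -- This is where l ≥ 2 is needed: for l = 1 the new 1s of row 1, in columns 0 and 1, would be adjacent.
  -i+1<l+i : ∀ i → - + i + 1ℤ ℤ.< + l + + i
  -i+1<l+i i = ℤP.≤-<-trans (ℤP.+-monoˡ-≤ 1ℤ (ℤP.neg-≤-pos {i} {0}))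
                             (ℤP.<-≤-trans (ℤ.+<+ (s≤s (s≤s z≤n))) (ℤP.i≤i+j (+ l) (+ i)))

  -i<l+i : ∀ i → - + i ℤ.< + l + + i
  -i<l+i i = ℤP.<-trans (i<i+1 (- + i)) (-i+1<l+i i)

  inRow-suc : ∀ i {c} → - + i ℤ.≤ c → c ℤ.≤ + l + + i → InRow l (suc i) c
  inRow-suc i {c} p q = subst (ℤ._≤ c) (sym (1-[1+i]≡-i i)) p , subst (c ℤ.≤_) (sym (l+[1+i]-1≡l+i l i)) q

  inRow⇒inRow-suc : ∀ i {c} → InRow l i c → InRow l (suc i) c
  inRow⇒inRow-suc i (p , q) = inRow-suc i (ℤP.<⇒≤ (ℤP.<-≤-trans (-i<start i) p)) (ℤP.≤-trans q (ℤP.<⇒≤ (i-1<i (+ l + + i))))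

  mutual
    Plus⊆row : ∀ i {c} → c ∈ Plus i → InRow l i c
    Plus⊆row (suc i) m with ∈Plus-suc⁻ i m
    ... | inj₁ (_ , refl) = inRow-suc i ℤP.≤-refl (ℤP.<⇒≤ (-i<l+i i))
    ... | inj₂ (inj₁ (_ , refl)) = inRow-suc i (ℤP.<⇒≤ (-i<l+i i)) ℤP.≤-refl
    ... | inj₂ (inj₂ s) =
      let (p , q) = shifted-bounds i s
      in inRow-suc i (ℤP.<⇒≤ (ℤP.<-trans (-i<start i) p)) (ℤP.≤-trans q (ℤP.<⇒≤ (i-1<i (+ l + + i))))

    shifted-bounds : ∀ i {c} → Shifted i c → (1ℤ - + i ℤ.< c) × (c ℤ.≤ + l + + i - 1ℤ)
    shifted-bounds i {c} (m , r) =
      let (y , y∈ , c-1<y) = find r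
      in ℤP.≤-<-trans (proj₁ (Plus⊆row i m)) (i-1<i c)
       , ℤP.≤-trans (ℤP.≤-reflexive (sym (i-1+1≡i c))) (i<j⇒i+1≤j (ℤP.<-≤-trans c-1<y (proj₂ (Plus⊆row i y∈))))

  Plus-no-adjacent : ∀ i {c} → c ∈ Plus i → c + 1ℤ ∈ Plus i → ⊥
  Plus-no-adjacent (suc i) {c} m m′ with ∈Plus-suc⁻ i m′
  ... | inj₁ (_ , e) =
    ℤP.≤⇒≯ (subst (ℤ._≤ c) (1-[1+i]≡-i i) (proj₁ (Plus⊆row (suc i) m))) (subst (c ℤ.<_) e (i<i+1 c))
  ... | inj₂ (inj₁ (_ , e)) with ∈Plus-suc⁻ i m
  ...   | inj₁ (_ , refl) = ℤP.<-irrefl e (-i+1<l+i i)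
  ...   | inj₂ (inj₁ (_ , refl)) = ℤP.<-irrefl (sym e) (i<i+1 c)
  ...   | inj₂ (inj₂ (m₀ , r)) =
    let (y , y∈ , c-1<y) = find r
        c≡end = trans (sym (i+1-1≡i c)) (cong (_- 1ℤ) e)
        y≡c = ℤP.≤-antisym (ℤP.≤-trans (proj₂ (Plus⊆row i y∈)) (ℤP.≤-reflexive (sym c≡end)))
                            (ℤP.≤-trans (ℤP.≤-reflexive (sym (i-1+1≡i c))) (i<j⇒i+1≤j c-1<y))
    in Plus-no-adjacent i m₀ (subst (_∈ Plus i) (trans y≡c (sym (i-1+1≡i c))) y∈)
  Plus-no-adjacent (suc i) {c} m m′ | inj₂ (inj₂ (m₀′ , _)) with ∈Plus-suc⁻ i m
  ...   | inj₁ (_ , refl) = ℤP.≤⇒≯ (proj₁ (Plus⊆row i (subst (_∈ Plus i) (i+1-1≡i c) m₀′))) (-i<start i)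
  ...   | inj₂ (inj₁ (_ , refl)) = ℤP.≤⇒≯ (proj₂ (Plus⊆row i (subst (_∈ Plus i) (i+1-1≡i c) m₀′))) (i-1<i (+ l + + i))
  ...   | inj₂ (inj₂ (m₀ , _)) = Plus-no-adjacent i m₀ (subst (_∈ Plus i) (trans (i+1-1≡i c) (sym (i-1+1≡i c))) m₀′)

  inRow∩Plus-suc⇒shifted : ∀ i {c} → InRow l i c → c ∈ Plus (suc i) → Shifted i c
  inRow∩Plus-suc⇒shifted i (p , q) m with ∈Plus-suc⁻ i m
  ... | inj₁ (_ , refl) = ⊥-elim (ℤP.≤⇒≯ p (-i<start i))
  ... | inj₂ (inj₁ (_ , refl)) = ⊥-elim (ℤP.≤⇒≯ q (i-1<i (+ l + + i)))
  ... | inj₂ (inj₂ s) = s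

  left∈Plus-suc⇒S : ∀ i → - + i ∈ Plus (suc i) → S (- + suc i) ≡ true
  left∈Plus-suc⇒S i m with ∈Plus-suc⁻ i m
  ... | inj₁ (e , _) = e
  ... | inj₂ (inj₁ (_ , e)) = ⊥-elim (ℤP.<-irrefl e (-i<l+i i))
  ... | inj₂ (inj₂ s) = ⊥-elim (ℤP.<-asym (proj₁ (shifted-bounds i s)) (-i<start i))

  right∈Plus-suc⇒S : ∀ i → + l + + i ∈ Plus (suc i) → S (+ suc i) ≡ true
  right∈Plus-suc⇒S i m with ∈Plus-suc⁻ i m
  ... | inj₁ (_ , e) = ⊥-elim (ℤP.<-irrefl (sym e) (-i<l+i i))
  ... | inj₂ (inj₁ (e , _)) = e
  ... | inj₂ (inj₂ s) = ⊥-elim (ℤP.≤⇒≯ (proj₂ (shifted-bounds i s)) (i-1<i (+ l + + i)))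

  χ : ℕ → ℤ → ℤ
  χ i c = 𝟙 (does (c ∈? Plus i))

  χ-left : ∀ i → χ (suc i) (- + i) ≡ 𝟙 (S (- + suc i))
  χ-left i = 𝟙-does≡𝟙 (_ ∈? _) (left∈Plus-suc⇒S i) (∈Plus-suc⁺-left i)

  χ-right : ∀ i → χ (suc i) (+ l + + i) ≡ 𝟙 (S (+ suc i))
  χ-right i = 𝟙-does≡𝟙 (_ ∈? _) (right∈Plus-suc⇒S i) (∈Plus-suc⁺-right i)

  AllBelow : ℕ → ℤ → Set
  AllBelow i c = All (ℤ._< c) (Plus i)

  allBelow? : ∀ i c → Dec (AllBelow i c)
  allBelow? i c = all? (ℤ._<? c) (Plus i)

  ∈⇒¬allBelow : ∀ i {c} → c ∈ Plus i → ¬ AllBelow i c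
  ∈⇒¬allBelow i m a = ℤP.<-irrefl refl (All.lookup a m)

  -- rowPrefix i c is the sum of the entries of row i of A′ in the columns up to c.
  rowPrefix : ℕ → ℤ → ℤ
  rowPrefix i c = χ i c + 𝟙 (does (allBelow? i c))

  rowEntry : ℕ → ℤ → ℤ
  rowEntry i c = χ i c - χ (suc i) c

  shift-balance : ∀ i c → InRow l i c →
    𝟙 (does (allBelow? i c)) + χ (suc i) c ≡ χ i (c - 1ℤ) + 𝟙 (does (allBelow? i (c - 1ℤ)))
  shift-balance i c r with (c - 1ℤ) ∈? Plus i | allBelow? i (c - 1ℤ)
  ... | yes m | yes a = ⊥-elim (∈⇒¬allBelow i m a)
  ... | no m∉ | yes a =
    cong₂ _+_ (𝟙-does⁺ (allBelow? i c) (All.map (λ p → ℤP.<-trans p (i-1<i c)) a))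
              (𝟙-does⁻ (c ∈? Plus (suc i)) (m∉ ∘ proj₁ ∘ inRow∩Plus-suc⇒shifted i r))
  ... | no m∉ | no ¬a =
    cong₂ _+_ (𝟙-does⁻ (allBelow? i c) ¬allBelow)
              (𝟙-does⁻ (c ∈? Plus (suc i)) (m∉ ∘ proj₁ ∘ inRow∩Plus-suc⇒shifted i r))
    where
    ¬allBelow : ¬ AllBelow i c
    ¬allBelow a =
      let (y , y∈ , c-1≤y) = ¬All<⇒≤ (Plus i) ¬a
      in m∉ (subst (_∈ Plus i) (ℤP.≤-antisym (i<j⇒i≤j-1 (All.lookup a y∈)) c-1≤y) y∈)
  ... | yes m | no _ with allBelow? i c
  ...   | yes a = cong (_+_ 1ℤ) (𝟙-does⁻ (c ∈? Plus (suc i)) λ m′ →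
    let (y , y∈ , c-1<y) = find (proj₂ (inRow∩Plus-suc⇒shifted i r m′))
    in ℤP.≤⇒≯ (ℤP.≤-trans (ℤP.≤-reflexive (sym (i-1+1≡i c))) (i<j⇒i+1≤j c-1<y)) (All.lookup a y∈))
  ...   | no ¬a = cong (_+_ 0ℤ) (𝟙-does⁺ (c ∈? Plus (suc i)) (∈Plus-suc⁺-shifted i (m , notRightmost)))
    where
    notRightmost : NotRightmost (Plus i) (c - 1ℤ)
    notRightmost = let (y , y∈ , c≤y) = ¬All<⇒≤ (Plus i) ¬a in lose y∈ (ℤP.<-≤-trans (i-1<i c) c≤y)

  rowPrefix-step : ∀ i c → InRow l i c → rowPrefix i c ≡ rowPrefix i (c - 1ℤ) + rowEntry i c
  rowPrefix-step i c r = begin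
    χ i c + a                                  ≡⟨ lemma (χ i c) a (χ (suc i) c) ⟩
    (a + χ (suc i) c) + rowEntry i c           ≡⟨ cong (_+ rowEntry i c) (shift-balance i c r) ⟩
    rowPrefix i (c - 1ℤ) + rowEntry i c        ∎
    where
    open ≡-Reasoning
    a = 𝟙 (does (allBelow? i c))
    lemma : ∀ x a y → x + a ≡ (a + y) + (x - y)
    lemma = solve-∀

  rowPrefix-bit : ∀ i c → Bit (rowPrefix i c)
  rowPrefix-bit i c with c ∈? Plus i | allBelow? i c
  ... | yes m | yes a = ⊥-elim (∈⇒¬allBelow i m a)
  ... | yes _ | no _ = inj₂ refl
  ... | no _ | yes _ = inj₂ refl
  ... | no _ | no _ = inj₁ refl

  rowPrefix-beforeStart : ∀ i → Σ ℤ (_∈ Plus i) → rowPrefix i (1ℤ - + i - 1ℤ) ≡ 0ℤ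
  rowPrefix-beforeStart i (x , x∈) =
    cong₂ _+_ (𝟙-does⁻ (_ ∈? Plus i) (λ m → ℤP.≤⇒≯ (proj₁ (Plus⊆row i m)) (i-1<i _)))
              (𝟙-does⁻ (allBelow? i _) (λ a → ℤP.≤⇒≯ (proj₁ (Plus⊆row i x∈)) (ℤP.<-trans (All.lookup a x∈) (i-1<i _))))

  rowPrefix-end : ∀ i → rowPrefix i (+ l + + i - 1ℤ) ≡ 1ℤ
  rowPrefix-end i with (+ l + + i - 1ℤ) ∈? Plus i
  ... | yes m = cong (_+_ 1ℤ) (𝟙-does⁻ (allBelow? i _) (∈⇒¬allBelow i m))
  ... | no m∉ = cong (_+_ 0ℤ) (𝟙-does⁺ (allBelow? i _) (All.tabulate λ {y} y∈ →
    ℤP.≤∧≢⇒< (proj₂ (Plus⊆row i y∈)) (λ e → m∉ (subst (_∈ Plus i) e y∈))))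

  private
    rowState : ℕ → ℤ → ℤ
    rowState i c = rowPrefix i (c - 1ℤ)

    rowState-step : ∀ i {c} → c ∈ rowCols l i → rowState i (c + 1ℤ) ≡ rowState i c + rowEntry i c
    rowState-step i {c} m = trans (cong (rowPrefix i) (i+1-1≡i c)) (rowPrefix-step i c (∈rowCols⁻ l′ i m))

  rowEntries-bitPrefixSums : ∀ i → Σ ℤ (_∈ Plus i) → BitPrefixSums 0ℤ (map (rowEntry i) (rowCols l i))
  rowEntries-bitPrefixSums i ne =
    subst (λ z → BitPrefixSums z (map (rowEntry i) (rowCols l i))) (rowPrefix-beforeStart i ne)
      (bitPrefixSums-rangeFrom (rowEntry i) (rowState i) _ _ (rowState-step i)
        (λ {c} _ → subst Bit (cong (rowPrefix i) (sym (i+1-1≡i c))) (rowPrefix-bit i c)))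

  rowEntries-sum : ∀ i → Σ ℤ (_∈ Plus i) → sumℤ (map (rowEntry i) (rowCols l i)) ≡ 1ℤ
  rowEntries-sum i ne = begin
    sumℤ (map (rowEntry i) (rowCols l i))                            ≡⟨ ℤP.+-identityˡ _ ⟨
    0ℤ + sumℤ (map (rowEntry i) (rowCols l i))                       ≡⟨ cong (_+ sumℤ (map (rowEntry i) (rowCols l i))) (rowPrefix-beforeStart i ne) ⟨
    rowState i (1ℤ - + i) + sumℤ (map (rowEntry i) (rowCols l i))    ≡⟨ telescope-rangeFrom (rowEntry i) (rowState i) _ _ (rowState-step i) ⟩
    rowState i (1ℤ - + i + + (l ℕ.+ (i ℕ.+ i) ℕ.∸ 1))               ≡⟨ cong (λ z → rowPrefix i (z - 1ℤ)) (rowCols-end l′ i) ⟩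
    rowPrefix i (+ l + + i - 1ℤ)                                     ≡⟨ rowPrefix-end i ⟩
    1ℤ                                                               ∎
    where open ≡-Reasoning

  isOne-rowEntry : ∀ i {c} → InRow l i c → 𝟙 (does (rowEntry i c ℤ.≟ 1ℤ)) ≡ χ i c
  isOne-rowEntry i {c} r with c ∈? Plus i | c ∈? Plus (suc i)
  ... | yes m | yes m′ =
    ⊥-elim (Plus-no-adjacent i (proj₁ (inRow∩Plus-suc⇒shifted i r m′)) (subst (_∈ Plus i) (sym (i-1+1≡i c)) m))
  ... | yes _ | no _ = refl
  ... | no _ | yes _ = refl
  ... | no _ | no _ = refl

  size : ℕ → ℤ
  size i = sumℤ (map (χ i) (rowCols l i))

  size-suc : ∀ i → size (suc i) ≡ 𝟙 (S (- + suc i)) + (sumℤ (map (χ (suc i)) (rowCols l i)) + (𝟙 (S (+ suc i)) + 0ℤ))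
  size-suc i = begin
    sumℤ (map (χ (suc i)) (rowCols l (suc i)))
      ≡⟨ cong (sumℤ ∘ map (χ (suc i))) (rowCols-suc l′ i) ⟩
    χ (suc i) (- + i) + sumℤ (map (χ (suc i)) (rowCols l i ++ (+ l + + i) ∷ []))
      ≡⟨ cong (_+_ (χ (suc i) (- + i))) (sumℤ-map-++ (χ (suc i)) (rowCols l i) _) ⟩
    χ (suc i) (- + i) + (sumℤ (map (χ (suc i)) (rowCols l i)) + (χ (suc i) (+ l + + i) + 0ℤ))
      ≡⟨ cong₂ (λ x y → x + (sumℤ (map (χ (suc i)) (rowCols l i)) + (y + 0ℤ))) (χ-left i) (χ-right i) ⟩
    𝟙 (S (- + suc i)) + (sumℤ (map (χ (suc i)) (rowCols l i)) + (𝟙 (S (+ suc i)) + 0ℤ))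
      ∎
    where open ≡-Reasoning

  size-pos⇒nonempty : ∀ i → 1ℤ ℤ.≤ size i → Σ ℤ (_∈ Plus i)
  size-pos⇒nonempty i 1≤size = nonempty (Plus i) refl
    where
    nonempty : ∀ xs → Plus i ≡ xs → Σ ℤ (_∈ Plus i)
    nonempty (x ∷ _) eq = x , subst (x ∈_) (sym eq) (here refl)
    nonempty [] eq = ⊥-elim (1≰0 (ℤP.≤-trans 1≤size (ℤP.≤-reflexive size≡0)))
      where
      size≡0 : size i ≡ 0ℤ
      size≡0 = sumℤ-map-zero (rowCols l i) λ _ → 𝟙-does⁻ (_ ∈? Plus i) λ m → case subst (_ ∈_) eq m of λ ()

  mutual
    shifted-size : ∀ j → j ≤ n → sumℤ (map (χ (suc j)) (rowCols l j)) ≡ sumM S j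
    shifted-size zero _ = sumℤ-map-zero (rowCols l 0) λ {c} m →
      𝟙-does⁻ (c ∈? Plus 1) λ m′ → case proj₁ (inRow∩Plus-suc⇒shifted 0 (∈rowCols⁻ l′ 0 m) m′) of λ ()
    shifted-size (suc j) j<n = begin
      sumℤ (map (χ (suc (suc j))) (rowCols l (suc j)))
        ≡⟨ i-j≡k⇒j≡i-k {size (suc j)} (sym (sumℤ-map-- (χ (suc j)) (χ (suc (suc j))) (rowCols l (suc j)))) ⟩
      size (suc j) - sumℤ (map (rowEntry (suc j)) (rowCols l (suc j)))
        ≡⟨ cong₂ _-_ (size≡ j j<n) (rowEntries-sum (suc j) (Plus-nonempty (suc j) (s≤s z≤n) j<n)) ⟩
      1ℤ + sumM S (suc j) - 1ℤ
        ≡⟨ lemma (sumM S (suc j)) ⟩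
      sumM S (suc j)
        ∎
      where
      open ≡-Reasoning
      lemma : ∀ s → 1ℤ + s - 1ℤ ≡ s
      lemma = solve-∀

    size≡ : ∀ j → suc j ≤ n → size (suc j) ≡ 1ℤ + sumM S (suc j)
    size≡ j j<n = begin
      size (suc j)                                        ≡⟨ size-suc j ⟩
      a + (sumℤ (map (χ (suc j)) (rowCols l j)) + (b + 0ℤ)) ≡⟨ cong (λ z → a + (z + (b + 0ℤ))) (shifted-size j (ℕP.<⇒≤ j<n)) ⟩
      a + (sumM S j + (b + 0ℤ))                           ≡⟨ lemma a b (sumM S j) ⟩
      1ℤ + (sumM S j + (a + b - 1ℤ))                      ≡⟨ cong (_+_ 1ℤ) (sumM-suc S j) ⟨
      1ℤ + sumM S (suc j)                                 ∎
      where
      open ≡-Reasoning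
      a = 𝟙 (S (- + suc j))
      b = 𝟙 (S (+ suc j))
      lemma : ∀ a b s → a + (s + (b + 0ℤ)) ≡ 1ℤ + (s + (a + b - 1ℤ))
      lemma = solve-∀

    Plus-nonempty : ∀ i → 1 ≤ i → i ≤ n → Σ ℤ (_∈ Plus i)
    Plus-nonempty (suc j) _ j<n = size-pos⇒nonempty (suc j)
      (ℤP.≤-trans (ℤP.≤-trans (ℤP.≤-reflexive (sym (ℤP.+-identityʳ 1ℤ))) (ℤP.+-monoʳ-≤ 1ℤ (sumM-nonneg (suc j) j<n)))
                  (ℤP.≤-reflexive (sym (size≡ j j<n))))

  Plus-top-empty : ∀ {c} → ¬ c ∈ Plus (suc n)
  Plus-top-empty {c} m = 1≰0 (begin
    1ℤ                  ≡⟨ 𝟙-does⁺ (c ∈? Plus (suc n)) m ⟨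
    χ (suc n) c         ≤⟨ ∈⇒≤sumℤ-map (χ (suc n)) (λ x → bit-nonneg (𝟙-bit _)) (∈rowCols⁺ l′ (suc n) (Plus⊆row (suc n) m)) ⟩
    size (suc n)        ≡⟨ size-suc n ⟩
    𝟙 (S (- + suc n)) + (sumℤ (map (χ (suc n)) (rowCols l n)) + (𝟙 (S (+ suc n)) + 0ℤ))
                        ≡⟨ cong₂ (λ x y → 𝟙 x + (y + (𝟙 (S (+ suc n)) + 0ℤ))) left-out (trans (shifted-size n ℕP.≤-refl) sumM-top) ⟩
    0ℤ + (0ℤ + (𝟙 (S (+ suc n)) + 0ℤ))
                        ≡⟨ cong (λ x → 0ℤ + (0ℤ + (𝟙 x + 0ℤ))) (S-right (ℤ.+<+ ℕP.≤-refl)) ⟩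
    0ℤ                  ∎)
    where
    open ℤP.≤-Reasoning
    left-out : S (- + suc n) ≡ false
    left-out = S-left (subst (ℤ._< - + n) (sym (-[1+i]≡-i-1 n)) (i-1<i (- + n)))

  inRow? : ∀ i c → Dec (InRow l i c)
  inRow? i c = (1ℤ - + i ℤ.≤? c) ×-dec (c ℤ.≤? + l + + i - 1ℤ)

  inShape? : ∀ i c → Dec (InShape n l i c)
  inShape? i c = (1 ℕ.≤? i) ×-dec ((i ℕ.≤? n) ×-dec inRow? i c)

  A′ : ℕ → ℤ → ℤ
  A′ i c with inShape? i c
  ... | yes _ = rowEntry i c
  ... | no _ = 0ℤ

  A′-inShape : ∀ {i c} → 1 ≤ i → i ≤ n → InRow l i c → A′ i c ≡ rowEntry i c
  A′-inShape {i} {c} 1≤i i≤n r with inShape? i c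
  ... | yes _ = refl
  ... | no ¬s = ⊥-elim (¬s (1≤i , i≤n , r))

  row-A′ : ∀ i → 1 ≤ i → i ≤ n → row l A′ i ≡ map (rowEntry i) (rowCols l i)
  row-A′ i 1≤i i≤n = map-cong-local (All.tabulate λ m → A′-inShape 1≤i i≤n (∈rowCols⁻ l′ i m))

  -- colSumFrom i c is the sum of column c of A′ over the rows i, …, n.
  colSumFrom : ℕ → ℤ → ℤ
  colSumFrom i c with inRow? i c
  ... | yes _ = χ i c
  ... | no _ = columnSumOf l S c

  colSumFrom-bit : ∀ i c → Bit (colSumFrom i c)
  colSumFrom-bit i c with inRow? i c
  ... | yes _ = 𝟙-bit _
  ... | no _ = columnSumOf-bit l S c

  inRow-suc∖inRow : ∀ i {c} → InRow l (suc i) c → ¬ InRow l i c → (c ≡ - + i) ⊎ (c ≡ + l + + i)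
  inRow-suc∖inRow i {c} (p , q) ¬r with 1ℤ - + i ℤ.≤? c
  ... | no start≰c = inj₁ (ℤP.≤-antisym (subst (c ℤ.≤_) (lemma (+ i)) (i<j⇒i≤j-1 (ℤP.≰⇒> start≰c)))
                                         (subst (ℤ._≤ c) (1-[1+i]≡-i i) p))
    where
    lemma : ∀ x → 1ℤ - x - 1ℤ ≡ - x
    lemma = solve-∀
  ... | yes start≤c with c ℤ.≤? + l + + i - 1ℤ
  ...   | yes c≤end = ⊥-elim (¬r (start≤c , c≤end))
  ...   | no c≰end = inj₂ (ℤP.≤-antisym (subst (c ℤ.≤_) (l+[1+i]-1≡l+i l i) q)
                                        (subst (ℤ._≤ c) (i-1+1≡i (+ l + + i)) (i<j⇒i+1≤j (ℤP.≰⇒> c≰end))))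

  colSumFrom-step : ∀ c {i} → 1 ≤ i → i ≤ n → colSumFrom i c ≡ colSumFrom (suc i) c + A′ i c
  colSumFrom-step c {i} 1≤i i≤n with inRow? i c | inRow? (suc i) c | inShape? i c
  ... | yes r | yes _ | yes _ = lemma (χ i c) (χ (suc i) c)
    where
    lemma : ∀ a b → a ≡ b + (a - b)
    lemma = solve-∀
  ... | yes r | no ¬r′ | _ = ⊥-elim (¬r′ (inRow⇒inRow-suc i r))
  ... | yes r | yes _ | no ¬s = ⊥-elim (¬s (1≤i , i≤n , r))
  ... | no ¬r | _ | yes s = ⊥-elim (¬r (proj₂ (proj₂ s)))
  ... | no _ | no _ | no _ = sym (ℤP.+-identityʳ _)
  ... | no ¬r | yes r′ | no _ with inRow-suc∖inRow i r′ ¬r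
  ...   | inj₁ refl = trans (columnSumOf-left l S i) (trans (sym (χ-left i)) (sym (ℤP.+-identityʳ _)))
  ...   | inj₂ refl = trans (columnSumOf-right l S (s≤s z≤n) i) (trans (sym (χ-right i)) (sym (ℤP.+-identityʳ _)))

  -- Outside the columns of row n + 1 the prescribed column sum asks for a label beyond ±n, which S lacks.
  colSumFrom-top : ∀ c → colSumFrom (suc n) c ≡ 0ℤ
  colSumFrom-top c with inRow? (suc n) c
  ... | yes _ = 𝟙-does⁻ (c ∈? Plus (suc n)) Plus-top-empty
  ... | no ¬r with c ℤ.≤? 0ℤ
  ...   | yes c≤0 = cong 𝟙 (S-left (ℤP.<-trans (i-1<i c) c<-n))
    where
    c<-n : c ℤ.< - + n
    c<-n with 1ℤ - + suc n ℤ.≤? c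
    ... | yes start≤c = ⊥-elim (¬r (start≤c , ℤP.≤-trans c≤0 (ℤ.+≤+ z≤n)))
    ... | no start≰c = subst (c ℤ.<_) (1-[1+i]≡-i n) (ℤP.≰⇒> start≰c)
  ...   | no c≰0 with + l ℤ.≤? c
  ...     | no _ = refl
  ...     | yes _ = cong 𝟙 (S-right n<x)
    where
    n<x : + n ℤ.< c - (+ l - 1ℤ)
    n<x with c ℤ.≤? + l + + suc n - 1ℤ
    ... | yes c≤end = ⊥-elim (¬r (ℤP.≤-trans (ℤP.≤-reflexive (1-[1+i]≡-i n)) (ℤP.≤-trans (ℤP.neg-≤-pos {n} {0}) (ℤP.<⇒≤ (ℤP.≰⇒> c≰0))) , c≤end))
    ... | no c≰end = ℤP.<-trans (ℤ.+<+ ℕP.≤-refl)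
        (subst (ℤ._< c - (+ l - 1ℤ)) (lemma (+ l) (+ n))
          (ℤP.+-monoˡ-< (- (+ l - 1ℤ)) (subst (ℤ._< c) (l+[1+i]-1≡l+i l n) (ℤP.≰⇒> c≰end))))
      where
      lemma : ∀ a x → a + x - (a - 1ℤ) ≡ 1ℤ + x
      lemma = solve-∀

  colSumFrom-bottom : ∀ c → colSumFrom 1 c ≡ columnSumOf l S c
  colSumFrom-bottom c with inRow? 1 c
  ... | no _ = refl
  ... | yes (p , q) with c ℤ.≤? 0ℤ
  ...   | yes c≤0 with ℤP.≤-antisym c≤0 p
  ...     | refl = χ-left 0
  colSumFrom-bottom c | yes (p , q) | no c≰0 with + l ℤ.≤? c
  ...   | yes l≤c with ℤP.≤-antisym (subst (c ℤ.≤_) (l+[1+i]-1≡l+i l 0) q) (subst (ℤ._≤ c) (sym (ℤP.+-identityʳ (+ l))) l≤c)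
  ...     | refl = trans (χ-right 0) (cong (𝟙 ∘ S) (lemma (+ l)))
    where
    lemma : ∀ a → 1ℤ ≡ a + 0ℤ - (a - 1ℤ)
    lemma = solve-∀
  colSumFrom-bottom c | yes (p , q) | no c≰0 | no l≰c =
    𝟙-does⁻ (c ∈? Plus 1) λ m → case proj₁ (inRow∩Plus-suc⇒shifted 0 (i<j⇒i+1≤j (ℤP.≰⇒> c≰0) , c≤) m) of λ ()
    where
    c≤ : c ℤ.≤ + l + + 0 - 1ℤ
    c≤ = subst (λ z → c ℤ.≤ z - 1ℤ) (sym (ℤP.+-identityʳ (+ l))) (i<j⇒i≤j-1 (ℤP.≰⇒> l≰c))

  column-A′-bitPrefixSums : ∀ c → BitPrefixSums 0ℤ (column n A′ c)
  column-A′-bitPrefixSums c =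
    subst (λ z → BitPrefixSums z (column n A′ c)) (colSumFrom-top c)
      (bitPrefixSums-topDown (λ j → A′ j c) (λ i → colSumFrom i c) n (colSumFrom-step c) (λ {i} _ _ → colSumFrom-bit i c))

  colSum-A′ : ∀ c → colSum n A′ c ≡ columnSumOf l S c
  colSum-A′ c = begin
    colSum n A′ c                                       ≡⟨ sumℤ-topDown (λ j → A′ j c) n ⟩
    sumTo (λ j → A′ j c) n                              ≡⟨ ℤP.+-identityˡ _ ⟨
    0ℤ + sumTo (λ j → A′ j c) n                         ≡⟨ cong (_+ sumTo (λ j → A′ j c) n) (colSumFrom-top c) ⟨
    colSumFrom (suc n) c + sumTo (λ j → A′ j c) n       ≡⟨ telescope-sumTo (λ j → A′ j c) (λ i → colSumFrom i c) n (colSumFrom-step c) n ℕP.≤-refl ⟨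
    colSumFrom 1 c                                      ≡⟨ colSumFrom-bottom c ⟩
    columnSumOf l S c                                   ∎
    where open ≡-Reasoning

  A′-entries : ∀ i c → IsEntry (A′ i c)
  A′-entries i c with inShape? i c
  ... | no _ = inj₂ (inj₁ refl)
  ... | yes _ with c ∈? Plus i | c ∈? Plus (suc i)
  ...   | yes _ | yes _ = inj₂ (inj₁ refl)
  ...   | yes _ | no _ = inj₂ (inj₂ refl)
  ...   | no _ | yes _ = inj₁ refl
  ...   | no _ | no _ = inj₂ (inj₁ refl)

  A′-outside : ∀ i c → ¬ InShape n l i c → A′ i c ≡ 0ℤ
  A′-outside i c ¬s with inShape? i c
  ... | yes s = ⊥-elim (¬s s)
  ... | no _ = refl

  A′-trapezoid : IsASTrapezoid n l A′
  A′-trapezoid = record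
    { entries = A′-entries
    ; outside = A′-outside
    ; rowSums = λ i 1≤i i≤n → trans (cong sumℤ (row-A′ i 1≤i i≤n)) (rowEntries-sum i (Plus-nonempty i 1≤i i≤n))
    ; colSums = λ c 1≤c c≤ → trans (colSum-A′ c) (columnSumOf-central l S 1≤c c≤)
    ; rowAlt = λ i 1≤i i≤n → bitPrefixSums⇒alternating (row l A′ i)
        (subst (BitPrefixSums 0ℤ) (sym (row-A′ i 1≤i i≤n)) (rowEntries-bitPrefixSums i (Plus-nonempty i 1≤i i≤n)))
    ; colAlt = λ c → bitPrefixSums⇒alternating _ (column-A′-bitPrefixSums c)
    ; colFirst = λ c → bitPrefixSums⇒firstPositive _ (column-A′-bitPrefixSums c)
    }

  A′-setOf≡ : SetOf≡ n l A′ S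
  A′-setOf≡ = columnSumOf⇒setOf≡ l′ n A′ S 0∈S colSum-A′

  ones-row-A′ : ∀ i → 1 ≤ i → i ≤ n → + ones (row l A′ i) ≡ 1ℤ + sumM S i
  ones-row-A′ (suc j) 1≤i i≤n = begin
    + ones (row l A′ (suc j))
      ≡⟨ ones-row l A′ (suc j) ⟩
    sumℤ (map (λ c → 𝟙 (does (A′ (suc j) c ℤ.≟ 1ℤ))) (rowCols l (suc j)))
      ≡⟨ sumℤ-map-cong (rowCols l (suc j)) (λ m → let r = ∈rowCols⁻ l′ (suc j) m in
           trans (cong (λ z → 𝟙 (does (z ℤ.≟ 1ℤ))) (A′-inShape 1≤i i≤n r)) (isOne-rowEntry (suc j) r)) ⟩
    size (suc j)
      ≡⟨ size≡ j i≤n ⟩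
    1ℤ + sumM S (suc j)
      ∎
    where open ≡-Reasoning

lemma3p1 : (l n : ℕ) → 1 ≤ l → (S : ℤ → Bool) → CentredCatalan (suc n) S →
    ((A : ℕ → ℤ → ℤ) → IsASTrapezoid n l A → SetOf≡ n l A S →
      ∀ i → 1 ≤ i → i ≤ n → + ones (row l A i) ≤ℤ 1ℤ + sumM S i)
    × (2 ≤ l → Σ (ℕ → ℤ → ℤ) (λ A′ → IsASTrapezoid n l A′ × SetOf≡ n l A′ S
      × (∀ i → 1 ≤ i → i ≤ n → + ones (row l A′ i) ≡ 1ℤ + sumM S i)))
lemma3p1 (suc zero) n _ S _ = (λ A → UpperBound.ones-row≤ 0 n A S) , λ { (s≤s ()) }
lemma3p1 (suc (suc l″)) n _ S catalan =
  (λ A → UpperBound.ones-row≤ (suc l″) n A S) , λ _ → A′ , A′-trapezoid , A′-setOf≡ , ones-row-A′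
  where open Construction l″ n S catalan
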